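{- Let $G$ be a 2-connected cubic graph and $u$ a vertex of $G$. Then $u$ is not nice in $G$ if and only if there exists a barrier $S$ of $G$ such that $u$ is an isolated vertex of $G-S$.
   Context: All graphs are finite, simple and connected. A vertex $u$ of a cubic graph $G$ is nice if $G-N_G[u]$ has a perfect matching, where $N_G[u]$ is the closed neighbourhood. For a graph $G$ with a perfect matching, a barrier is a set $S\subseteq V(G)$ with $o(G-S)=|S|$, where $o(\cdot)$ is the number of odd components. -}

module Defs where

open import Data.Nat using (ℕ; _%_; _≤_)
open import Data.Bool using (Bool; true; false; _∨_)
open import Data.Fin using (Fin; _≟_)
open import Data.Fin.Subset using (Subset; _∈_; _∉_; ∣_∣; ∁; _⊆_)
open import Data.Vec using (tabulate)
open import Data.List using (List; length)
open import Data.List.Relation.Unary.All using (All)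
open import Data.List.Relation.Unary.Unique.Propositional using (Unique)
import Data.List.Membership.Propositional as LM
open import Data.Product using (Σ; ∃; _×_)
open import Relation.Binary.PropositionalEquality using (_≡_)
open import Relation.Nullary.Decidable using (⌊_⌋)

record Graph (n : ℕ) : Set where
  field
    adj   : Fin n → Fin n → Bool
    sym   : ∀ u v → adj u v ≡ adj v u
    loopless : ∀ u → adj u u ≡ false
open Graph public

module _ {n : ℕ} (G : Graph n) where

  N : Fin n → Subset n
  N u = tabulate (adj G u)

  N[_] : Fin n → Subset n
  N[ u ] = tabulate (λ v → adj G u v ∨ ⌊ u ≟ v ⌋)

  degree : Fin n → ℕ
  degree u = ∣ N u ∣

  Cubic : Set
  Cubic = ∀ u → degree u ≡ 3

  data Walk (X : Subset n) : Fin n → Fin n → Set where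
    here : ∀ {u} → u ∈ X → Walk X u u
    step : ∀ {u w v} → u ∈ X → adj G u w ≡ true → Walk X w v → Walk X u v

  ConnectedOn : Subset n → Set
  ConnectedOn X = ∀ u v → u ∈ X → v ∈ X → Walk X u v

  Connected : Set
  Connected = ConnectedOn (tabulate (λ _ → true))

  minus : Fin n → Subset n
  minus v = ∁ (Data.Fin.Subset.⁅ v ⁆)

  TwoConnected : Set
  TwoConnected = 3 ≤ n × Connected × (∀ v → ConnectedOn (minus v))

  IsComponent : Subset n → Subset n → Set
  IsComponent X C =
    C ⊆ X × (∃ λ v → v ∈ C) × (∀ u v → u ∈ C → v ∈ C → Walk X u v)
    × (∀ u w → u ∈ C → w ∈ X → adj G u w ≡ true → w ∈ C)

  IsOddComponent : Subset n → Subset n → Set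
  IsOddComponent X C = IsComponent X C × ∣ C ∣ % 2 ≡ 1

  NumOddComponents : Subset n → ℕ → Set
  NumOddComponents X k = Σ (List (Subset n)) λ L →
    Unique L × All (IsOddComponent X) L × (∀ C → IsOddComponent X C → C LM.∈ L)
    × length L ≡ k

  Barrier : Subset n → Set
  Barrier S = NumOddComponents (∁ S) ∣ S ∣

  PerfectMatchingOn : Subset n → Set
  PerfectMatchingOn X = Σ (Fin n → Fin n → Bool) λ M →
    (∀ u v → M u v ≡ M v u)
    × (∀ u v → M u v ≡ true → adj G u v ≡ true × u ∈ X × v ∈ X)
    × (∀ u → u ∈ X → ∃ λ w → M u w ≡ true × (∀ w' → M u w' ≡ true → w' ≡ w))

  Nice : Fin n → Set
  Nice u = PerfectMatchingOn (∁ N[ u ])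

  IsolatedIn : Fin n → Subset n → Set
  IsolatedIn u S = u ∉ S × (∀ v → adj G u v ≡ true → v ∈ S)

-- Write X = V ∖ N[u]. If G − N[u] has no perfect matching, Tutte's theorem gives T ⊆ X with
-- o(X − T) > |T|, and since |X| = n − 4 is even (a cubic graph has even order), o(X − T) ≥ |T| + 2.
-- For S = T ∪ N(u) the graph G − S consists of X − T and the isolated vertex u, so
-- o(G − S) ≥ |T| + 3 = |S|. In a 2-connected cubic graph every odd component of G − S sends an odd
-- number of edges, at least two and hence at least three, to S; as S receives at most 3|S| edges,
-- o(G − S) ≤ |S|, and S is a barrier. Conversely, if S is a barrier with u isolated in G − S, then
-- T = S ∖ N(u) satisfies o(X − T) = |S| − 1 = |T| + 2, so X has no perfect matching.
--
-- Tutte's theorem is proved as by Lovász: add missing edges inside X as long as no perfect matching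
-- appears. In an edge-maximal graph let S be the set of vertices adjacent to all of X. Either S
-- violates Tutte's condition, or every component of X − S is complete and a perfect matching is
-- built greedily, or two perfect matchings of H + ac and H + bd (with a ~ b ~ c, a ≁ c, b ≁ d)
-- are combined along an alternating cycle into one of H.

{-# OPTIONS --safe #-}
module Submission where

open import Data.Nat using (ℕ; zero; suc; _+_; _*_; _∸_; _≤_; _<_; _≤?_; z≤n; s≤s; _%_)
open import Data.Nat.Properties hiding (_≟_)
open import Data.Nat.DivMod using ([m+n]%n≡m%n)
open import Data.Bool using (Bool; true; false; _∧_; _∨_; not; _xor_; if_then_else_)
open import Data.Bool.Properties using (∨-zeroʳ; ∧-zeroʳ; ∧-identityʳ; not-involutive) renaming (_≟_ to _≟b_)
open import Algebra.Properties.CommutativeSemigroup +-commutativeSemigroup using (interchange)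
open import Data.Fin as Fin using (Fin; zero; suc; _≟_; toℕ)
import Data.Fin.Properties as FinP
open import Data.Fin.Subset using (Subset; _∈_; _∉_; ∣_∣; ∁; ⁅_⁆; _⊆_)
open import Data.Fin.Subset.Properties using (x∈∁p⇒x∉p; x∉p⇒x∈∁p; x∈⁅x⁆; x∈⁅y⁆⇒x≡y)
open import Data.Vec using ([]; _∷_; lookup; tabulate)
open import Data.Vec.Properties using (lookup∘tabulate; tabulate∘lookup; tabulate-cong; lookup-map; []=⇒lookup; lookup⇒[]=)
import Data.Vec.Properties as VP
open import Data.List using (List; []; _∷_; map; length)
import Data.List as List
open import Data.List.Properties using (length-map)
open import Data.List.Relation.Unary.All using (All; []; _∷_)
import Data.List.Relation.Unary.All as All
open import Data.List.Relation.Unary.AllPairs using ([]; _∷_)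
open import Data.List.Relation.Unary.Any using (here; there)
open import Data.List.Relation.Unary.Unique.Propositional using (Unique)
import Data.List.Membership.Propositional as LM
open import Data.List.Membership.Propositional.Properties using (∈-lookup; ∈-map⁺; ∈-map⁻)
open import Data.Maybe using (Maybe; just; nothing; fromMaybe)
open import Data.Product using (Σ; ∃; _×_; _,_; proj₁; proj₂)
open import Data.Sum using (_⊎_; inj₁; inj₂)
open import Data.Empty using (⊥; ⊥-elim)
open import Function.Bundles using (_⇔_; mk⇔)
open import Relation.Nullary using (¬_; Dec; yes; no; ¬?)
open import Relation.Nullary.Decidable using (⌊_⌋; _×-dec_)
open import Relation.Binary.Definitions using (tri<; tri≈; tri>)
open import Relation.Binary.PropositionalEquality
open import Defs renaming (sym to gsym)

anyF : ∀ {n} → (Fin n → Bool) → Bool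
anyF {zero} p = false
anyF {suc n} p = p zero ∨ anyF (λ i → p (suc i))

allF : ∀ {n} → (Fin n → Bool) → Bool
allF {zero} p = true
allF {suc n} p = p zero ∧ allF (λ i → p (suc i))

anyF-intro : ∀ {n} (p : Fin n → Bool) i → p i ≡ true → anyF p ≡ true
anyF-intro p zero e rewrite e = refl
anyF-intro p (suc i) e with p zero
... | true = refl
... | false = anyF-intro (λ i → p (suc i)) i e

anyF-elim : ∀ {n} (p : Fin n → Bool) → anyF p ≡ true → ∃ λ i → p i ≡ true
anyF-elim {zero} p ()
anyF-elim {suc n} p e with p zero in eq
... | true = zero , eq
... | false = let (i , q) = anyF-elim (λ i → p (suc i)) e in suc i , q

allF-elim : ∀ {n} (p : Fin n → Bool) → allF p ≡ true → ∀ i → p i ≡ true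
allF-elim {suc n} p e zero with p zero
allF-elim {suc n} p e zero | true = refl
allF-elim {suc n} p e (suc i) with p zero
... | true = allF-elim (λ i → p (suc i)) e i

allF-intro : ∀ {n} (p : Fin n → Bool) → (∀ i → p i ≡ true) → allF p ≡ true
allF-intro {zero} p f = refl
allF-intro {suc n} p f rewrite f zero = allF-intro (λ i → p (suc i)) (λ i → f (suc i))

allF-false : ∀ {n} (p : Fin n → Bool) → allF p ≡ false → ∃ λ i → p i ≡ false
allF-false {zero} p ()
allF-false {suc n} p e with p zero in eq
... | false = zero , eq
... | true = let (i , q) = allF-false (λ i → p (suc i)) e in suc i , q

anyF-false : ∀ {n} (p : Fin n → Bool) → anyF p ≡ false → ∀ i → p i ≡ false
anyF-false p e i with p i in eq
... | false = refl
... | true = trans (sym (anyF-intro p i eq)) e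

allF-cong : ∀ {n} {p q : Fin n → Bool} → (∀ i → p i ≡ q i) → allF p ≡ allF q
allF-cong {zero} e = refl
allF-cong {suc n} e = cong₂ _∧_ (e zero) (allF-cong (λ i → e (suc i)))

eqb : ∀ {n} → Fin n → Fin n → Bool
eqb x y = ⌊ x ≟ y ⌋

eqb-true : ∀ {n} {x y : Fin n} → eqb x y ≡ true → x ≡ y
eqb-true {x = x} {y} e with x ≟ y
... | yes p = p

eqb-refl : ∀ {n} (x : Fin n) → eqb x x ≡ true
eqb-refl x with x ≟ x
... | yes _ = refl
... | no ne = ⊥-elim (ne refl)

eqb-false : ∀ {n} {x y : Fin n} → ¬ x ≡ y → eqb x y ≡ false
eqb-false {x = x} {y} ne with x ≟ y
... | yes p = ⊥-elim (ne p)
... | no _ = refl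

eqb-sym : ∀ {n} (x y : Fin n) → eqb x y ≡ eqb y x
eqb-sym x y with x ≟ y | y ≟ x
... | yes _ | yes _ = refl
... | no _ | no _ = refl
... | yes p | no q = ⊥-elim (q (sym p))
... | no p | yes q = ⊥-elim (p (sym q))

∧-true : ∀ {a b} → a ∧ b ≡ true → a ≡ true × b ≡ true
∧-true {true} {true} _ = refl , refl

∧-intro : ∀ {a b} → a ≡ true → b ≡ true → a ∧ b ≡ true
∧-intro refl refl = refl

∨-true : ∀ {a b} → a ∨ b ≡ true → a ≡ true ⊎ b ≡ true
∨-true {true} _ = inj₁ refl
∨-true {false} e = inj₂ e

true≢false : ∀ {b} → b ≡ true → b ≡ false → ⊥
true≢false refl ()

not≡false : ∀ {b} → not b ≡ false → b ≡ true
not≡false {true} _ = refl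

not≡true : ∀ {b} → not b ≡ true → b ≡ false
not≡true {false} _ = refl

bool-iff : ∀ {a b} → (a ≡ true → b ≡ true) → (b ≡ true → a ≡ true) → a ≡ b
bool-iff {true} f g = sym (f refl)
bool-iff {false} {true} f g = g refl
bool-iff {false} {false} f g = refl

not-∧ : ∀ {a b} → not (a ∧ b) ≡ true → a ≡ true → b ≡ true → ⊥
not-∧ q refl refl = true≢false q refl

ltb : ∀ {n} → Fin n → Fin n → Bool
ltb x y = ⌊ x Fin.<? y ⌋

ltb-true : ∀ {n} {x y : Fin n} → x Fin.< y → ltb x y ≡ true
ltb-true {x = x} {y} lt with x Fin.<? y
... | yes _ = refl
... | no ne = ⊥-elim (ne lt)

least : ∀ {n} (p : Fin n → Bool) i → p i ≡ true → ∃ λ m → p m ≡ true × (∀ x → x Fin.< m → p x ≡ false)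
least {suc n} p i e with p zero in e0
... | true = zero , e0 , (λ x ())
least {suc n} p zero e | false = ⊥-elim (true≢false e e0)
least {suc n} p (suc i) e | false with least (λ x → p (suc x)) i e
... | m , pm , lt = suc m , pm , f
  where
  f : ∀ x → x Fin.< suc m → p x ≡ false
  f zero _ = e0
  f (suc x) (s≤s l) = lt x l

-- Finite sums, counting and parity

∑ : ∀ {n} → (Fin n → ℕ) → ℕ
∑ {zero} f = 0
∑ {suc n} f = f zero + ∑ (λ i → f (suc i))

bit : Bool → ℕ
bit true = 1
bit false = 0

# : ∀ {n} → (Fin n → Bool) → ℕ
# p = ∑ (λ i → bit (p i))

oddb : ℕ → Bool
oddb zero = false
oddb (suc n) = not (oddb n)

∑-cong : ∀ {n} {f g : Fin n → ℕ} → (∀ i → f i ≡ g i) → ∑ f ≡ ∑ g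
∑-cong {zero} e = refl
∑-cong {suc n} e = cong₂ _+_ (e zero) (∑-cong (λ i → e (suc i)))

∑-mono : ∀ {n} {f g : Fin n → ℕ} → (∀ i → f i ≤ g i) → ∑ f ≤ ∑ g
∑-mono {zero} e = z≤n
∑-mono {suc n} e = +-mono-≤ (e zero) (∑-mono (λ i → e (suc i)))

∑-+ : ∀ {n} (f g : Fin n → ℕ) → ∑ (λ i → f i + g i) ≡ ∑ f + ∑ g
∑-+ {zero} f g = refl
∑-+ {suc n} f g = trans (cong (f zero + g zero +_) (∑-+ (λ i → f (suc i)) (λ i → g (suc i))))
  (interchange (f zero) (g zero) (∑ (λ i → f (suc i))) (∑ (λ i → g (suc i))))

∑-swap : ∀ {n m} (f : Fin n → Fin m → ℕ) → ∑ (λ i → ∑ (λ j → f i j)) ≡ ∑ (λ j → ∑ (λ i → f i j))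
∑-swap {zero} {m} f = sym (∑-zero' m)
  where
  ∑-zero' : ∀ m → ∑ {m} (λ j → 0) ≡ 0
  ∑-zero' zero = refl
  ∑-zero' (suc m) = ∑-zero' m
∑-swap {suc n} {m} f = trans (cong (∑ (f zero) +_) (∑-swap (λ i j → f (suc i) j)))
  (sym (∑-+ (λ j → f zero j) (λ j → ∑ (λ i → f (suc i) j))))

∑-0 : ∀ {n} {f : Fin n → ℕ} → (∀ i → f i ≡ 0) → ∑ f ≡ 0
∑-0 {zero} e = refl
∑-0 {suc n} e = cong₂ _+_ (e zero) (∑-0 (λ i → e (suc i)))

∑-single : ∀ {n} {f : Fin n → ℕ} (k : Fin n) → (∀ i → ¬ i ≡ k → f i ≡ 0) → ∑ f ≡ f k
∑-single {suc n} {f} zero e = trans (cong (f zero +_) (∑-0 (λ i → e (suc i) (λ ())))) (+-identityʳ _)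
∑-single {suc n} {f} (suc k) e = trans (cong₂ _+_ (e zero (λ ())) (∑-single k (λ i ne → e (suc i) (λ eq → ne (FinP.suc-injective eq))))) refl

∑-const : ∀ {n} c → ∑ {n} (λ _ → c) ≡ n * c
∑-const {zero} c = refl
∑-const {suc n} c = cong (c +_) (∑-const {n} c)

∑-*ˡ : ∀ {n} c (f : Fin n → ℕ) → ∑ (λ i → c * f i) ≡ c * ∑ f
∑-*ˡ {zero} c f = sym (*-zeroʳ c)
∑-*ˡ {suc n} c f = trans (cong (c * f zero +_) (∑-*ˡ c (λ i → f (suc i)))) (sym (*-distribˡ-+ c (f zero) _))

∑-strict : ∀ {n} {f g : Fin n → ℕ} (k : Fin n) → (∀ i → f i ≤ g i) → f k < g k → suc (∑ f) ≤ ∑ g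
∑-strict {suc n} zero le lt = +-mono-≤ lt (∑-mono (λ i → le (suc i)))
∑-strict {suc n} {f} {g} (suc k) le lt =
  subst (_≤ g zero + ∑ (λ i → g (suc i))) (+-suc (f zero) _) (+-mono-≤ (le zero) (∑-strict k (λ i → le (suc i)) lt))

∑-pos : ∀ {n} {f : Fin n → ℕ} → 0 < ∑ f → ∃ λ i → 0 < f i
∑-pos {zero} ()
∑-pos {suc n} {f} lt with f zero in eq
... | zero = let (i , p) = ∑-pos {n} {λ i → f (suc i)} lt in suc i , p
... | suc m = zero , subst (0 <_) (sym eq) (s≤s z≤n)

∑-≥ : ∀ {n} {f : Fin n → ℕ} (k : Fin n) → f k ≤ ∑ f
∑-≥ {suc n} {f} zero = m≤m+n (f zero) _
∑-≥ {suc n} {f} (suc k) = ≤-trans (∑-≥ {n} {λ i → f (suc i)} k) (m≤n+m _ (f zero))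

∑-two : ∀ {n} {f : Fin n → ℕ} (a b : Fin n) → ¬ a ≡ b → 1 ≤ f a → 1 ≤ f b → 2 ≤ ∑ f
∑-two {suc n} {f} zero zero ne _ _ = ⊥-elim (ne refl)
∑-two {suc n} {f} zero (suc b) ne fa fb = +-mono-≤ fa (≤-trans fb (∑-≥ {n} {λ i → f (suc i)} b))
∑-two {suc n} {f} (suc a) zero ne fa fb = subst (_≤ f zero + ∑ (λ i → f (suc i))) (+-comm 1 1)
   (+-mono-≤ fb (≤-trans fa (∑-≥ {n} {λ i → f (suc i)} a)))
∑-two {suc n} {f} (suc a) (suc b) ne fa fb = ≤-trans (∑-two {n} {λ i → f (suc i)} a b (λ e → ne (cong suc e)) fa fb) (m≤n+m _ (f zero))

bit≤1 : ∀ b → bit b ≤ 1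
bit≤1 true = s≤s z≤n
bit≤1 false = z≤n

#≤n : ∀ {n} (p : Fin n → Bool) → # p ≤ n
#≤n {n} p = subst (# p ≤_) (trans (∑-const {n} 1) (*-identityʳ n)) (∑-mono (λ i → bit≤1 (p i)))

∑-except : ∀ {n} (f g : Fin n → ℕ) k → f k ≡ suc (g k) → (∀ i → ¬ i ≡ k → f i ≡ g i) → ∑ f ≡ suc (∑ g)
∑-except f g k fk fi = begin
  ∑ f ≡⟨ ∑-cong pt ⟩
  ∑ (λ i → bit (eqb i k) + g i) ≡⟨ ∑-+ (λ i → bit (eqb i k)) g ⟩
  ∑ (λ i → bit (eqb i k)) + ∑ g ≡⟨ cong (_+ ∑ g) (trans (∑-single k z) (cong bit (eqb-refl k))) ⟩
  suc (∑ g) ∎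
  where
  open ≡-Reasoning
  pt : ∀ i → f i ≡ bit (eqb i k) + g i
  pt i with i ≟ k
  ... | yes refl = fk
  ... | no ne = fi i ne
  z : ∀ i → ¬ i ≡ k → bit (eqb i k) ≡ 0
  z i ne rewrite eqb-false ne = refl

#-cong : ∀ {n} {A B : Fin n → Bool} → (∀ x → A x ≡ B x) → # A ≡ # B
#-cong e = ∑-cong (λ x → cong bit (e x))

∑∑-two : ∀ {n m} (f : Fin n → Fin m → ℕ) x0 s0 x1 s1 → 1 ≤ f x0 s0 → 1 ≤ f x1 s1 → (¬ x0 ≡ x1 ⊎ ¬ s0 ≡ s1) → 2 ≤ ∑ (λ x → ∑ (λ s → f x s))
∑∑-two f x0 s0 x1 s1 p0 p1 (inj₁ ne) = ∑-two {f = λ x → ∑ (λ s → f x s)} x0 x1 ne (≤-trans p0 (∑-≥ {f = f x0} s0)) (≤-trans p1 (∑-≥ {f = f x1} s1))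
∑∑-two f x0 s0 x1 s1 p0 p1 (inj₂ ne) with x0 ≟ x1
... | yes refl = ≤-trans (∑-two {f = f x0} s0 s1 ne p0 p1) (∑-≥ {f = λ x → ∑ (λ s → f x s)} x0)
... | no nx = ∑-two {f = λ x → ∑ (λ s → f x s)} x0 x1 nx (≤-trans p0 (∑-≥ {f = f x0} s0)) (≤-trans p1 (∑-≥ {f = f x1} s1))

oddb-+ : ∀ m n → oddb (m + n) ≡ oddb m xor oddb n
oddb-+ zero n = refl
oddb-+ (suc m) n rewrite oddb-+ m n with oddb m | oddb n
... | true | true = refl
... | true | false = refl
... | false | true = refl
... | false | false = refl

oddb-2* : ∀ m → oddb (m + m) ≡ false
oddb-2* m rewrite oddb-+ m m with oddb m
... | true = refl
... | false = refl

oddb-3* : ∀ m → oddb (3 * m) ≡ oddb m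
oddb-3* m rewrite +-identityʳ m | oddb-+ m (m + m) | oddb-2* m with oddb m
... | true = refl
... | false = refl

oddb-2*+1 : ∀ m → oddb (suc (m + m)) ≡ true
oddb-2*+1 m = cong not (oddb-2* m)

odd⇒pos : ∀ {m} → oddb m ≡ true → 0 < m
odd⇒pos {suc m} _ = s≤s z≤n

∑-odd : ∀ {n} (f : Fin n → ℕ) → oddb (∑ f) ≡ true → ∃ λ i → oddb (f i) ≡ true
∑-odd {zero} f ()
∑-odd {suc n} f o with oddb (f zero) in e
... | true = zero , e
... | false = let (i , p) = ∑-odd (λ i → f (suc i)) (trans (sym (xor-false-left (oddb-+ (f zero) _) e)) o) in suc i , p
  where
  xor-false-left : ∀ {a b c} → oddb (f zero + c) ≡ a xor b → a ≡ false → oddb (f zero + c) ≡ b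
  xor-false-left {false} p refl = p

∑-oddb : ∀ {n} (f : Fin n → ℕ) → oddb (∑ f) ≡ oddb (∑ (λ i → bit (oddb (f i))))
∑-oddb {zero} f = refl
∑-oddb {suc n} f rewrite oddb-+ (f zero) (∑ (λ i → f (suc i))) | oddb-+ (bit (oddb (f zero))) (∑ (λ i → bit (oddb (f (suc i)))))
  | ∑-oddb (λ i → f (suc i)) with oddb (f zero)
... | true = refl
... | false = refl

∑∑-symmetric-even : ∀ {n} (f : Fin n → Fin n → ℕ) → (∀ i j → f i j ≡ f j i) → (∀ i → f i i ≡ 0) → oddb (∑ (λ i → ∑ (λ j → f i j))) ≡ false
∑∑-symmetric-even {zero} f s z = refl
∑∑-symmetric-even {suc n} f s z = trans (cong oddb eq) (trans (oddb-+ (A + A) R) (cong₂ _xor_ (oddb-2* A) ih))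
  where
  A : ℕ
  A = ∑ (λ j → f zero (suc j))
  R : ℕ
  R = ∑ (λ i → ∑ (λ j → f (suc i) (suc j)))
  ih : oddb R ≡ false
  ih = ∑∑-symmetric-even (λ i j → f (suc i) (suc j)) (λ i j → s (suc i) (suc j)) (λ i → z (suc i))
  eq : f zero zero + A + ∑ (λ i → f (suc i) zero + ∑ (λ j → f (suc i) (suc j))) ≡ A + A + R
  eq = begin
    f zero zero + A + ∑ (λ i → f (suc i) zero + ∑ (λ j → f (suc i) (suc j)))
      ≡⟨ cong₂ _+_ (cong (_+ A) (z zero)) (∑-+ (λ i → f (suc i) zero) (λ i → ∑ (λ j → f (suc i) (suc j)))) ⟩
    A + (∑ (λ i → f (suc i) zero) + R) ≡⟨ cong (λ t → A + (t + R)) (∑-cong (λ i → s (suc i) zero)) ⟩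
    A + (A + R) ≡⟨ sym (+-assoc A A R) ⟩
    A + A + R ∎
    where open ≡-Reasoning

%2≡bit : ∀ m → m % 2 ≡ bit (oddb m)
%2≡bit zero = refl
%2≡bit (suc zero) = refl
%2≡bit (suc (suc m)) = trans (cong (_% 2) (+-comm 2 m)) (trans ([m+n]%n≡m%n m 2) (trans (%2≡bit m) (cong bit (sym (not-involutive (oddb m))))))

#≤#-injection : ∀ {n m} (P : Fin n → Bool) (Q : Fin m → Bool) (R : Fin n → Fin m → Bool) →
  (∀ i → P i ≡ true → ∃ λ j → R i j ≡ true) →
  (∀ i j → R i j ≡ true → Q j ≡ true) →
  (∀ i i' j → R i j ≡ true → R i' j ≡ true → i ≡ i') → # P ≤ # Q
#≤#-injection {n} {m} P Q R total R⇒Q injective = begin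
  ∑ (λ i → bit (P i))             ≤⟨ ∑-mono out-degree ⟩
  ∑ (λ i → ∑ (λ j → bit (R i j))) ≡⟨ ∑-swap (λ i j → bit (R i j)) ⟩
  ∑ (λ j → ∑ (λ i → bit (R i j))) ≤⟨ ∑-mono in-degree ⟩
  ∑ (λ j → bit (Q j))             ∎
  where
  open ≤-Reasoning
  out-degree : ∀ i → bit (P i) ≤ ∑ (λ j → bit (R i j))
  out-degree i with P i in e
  ... | false = z≤n
  ... | true = let (j , r) = total i e in ≤-trans (subst (λ b → 1 ≤ bit b) (sym r) ≤-refl) (∑-≥ {f = λ j → bit (R i j)} j)
  in-degree : ∀ j → ∑ (λ i → bit (R i j)) ≤ bit (Q j)
  in-degree j with FinP.any? (λ i → R i j ≟b true)
  ... | no none = subst (_≤ bit (Q j)) (sym (∑-0 (λ i → cong bit (¬-not none i)))) z≤n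
    where
    ¬-not : (¬ ∃ λ i → R i j ≡ true) → ∀ i → R i j ≡ false
    ¬-not none i with R i j in e
    ... | false = refl
    ... | true = ⊥-elim (none (i , e))
  ... | yes (i₀ , r₀) = subst (_≤ bit (Q j)) (sym (∑-single i₀ others)) (subst₂ (λ a b → bit a ≤ bit b) (sym r₀) (sym (R⇒Q i₀ j r₀)) ≤-refl)
    where
    others : ∀ i → ¬ i ≡ i₀ → bit (R i j) ≡ 0
    others i i≢i₀ with R i j in e
    ... | false = refl
    ... | true = ⊥-elim (i≢i₀ (injective i i₀ j e r₀))

#≤1 : ∀ {n} (p : Fin n → Bool) → (∀ i j → p i ≡ true → p j ≡ true → i ≡ j) → # p ≤ 1
#≤1 p u = #≤#-injection p (λ (_ : Fin 1) → true) (λ i _ → p i) (λ i e → zero , e) (λ _ _ _ → refl) (λ i i' _ e1 e2 → u i i' e1 e2)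

bit-split : ∀ a c → bit a ≡ bit (a ∧ c) + bit (a ∧ not c)
bit-split true true = refl
bit-split true false = refl
bit-split false c = refl

bit-mono : ∀ {a b} → (a ≡ true → b ≡ true) → bit a ≤ bit b
bit-mono {false} f = z≤n
bit-mono {true} f rewrite f refl = s≤s z≤n

bitnot : ∀ b → bit (not b) + bit b ≡ 1
bitnot true = refl
bitnot false = refl

≤-by-parity : ∀ {a b} → a ≤ suc b → oddb a ≡ oddb b → a ≤ b
≤-by-parity {a} {b} le e with m≤n⇒m<n∨m≡n le
... | inj₁ l = ≤-pred l
... | inj₂ refl = ⊥-elim (nb (oddb b) e)
  where
  nb : ∀ t → not t ≡ t → ⊥
  nb true ()
  nb false ()

xor-false : ∀ {a b} → a xor b ≡ false → a ≡ b
xor-false {true} {true} _ = refl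
xor-false {false} {false} _ = refl

#-true : ∀ m → # {m} (λ _ → true) ≡ m
#-true m = trans (∑-const {m} 1) (*-identityʳ m)

#-not-parity : ∀ {n} → oddb n ≡ false → (Sb : Fin n → Bool) → oddb (# (λ x → not (Sb x))) ≡ oddb (# Sb)
#-not-parity {n} n-even Sb = xor-false (trans (sym (oddb-+ (# (λ x → not (Sb x))) (# Sb))) (trans (cong oddb total) n-even))
  where
  total : # (λ x → not (Sb x)) + # Sb ≡ n
  total = trans (sym (∑-+ (λ x → bit (not (Sb x))) (λ x → bit (Sb x)))) (trans (∑-cong (λ x → bitnot (Sb x))) (#-true n))

bit≡1 : ∀ {b} → bit b ≡ 1 → b ≡ true
bit≡1 {true} _ = refl

even-or-odd : ∀ d → ∃ λ m → (d ≡ m + m) ⊎ (d ≡ suc (m + m))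
even-or-odd zero = 0 , inj₁ refl
even-or-odd (suc d) with even-or-odd d
... | m , inj₁ e = m , inj₂ (cong suc e)
... | m , inj₂ e = suc m , inj₁ (trans (cong suc e) (cong suc (sym (+-suc m m))))

even-<-step : ∀ i L → oddb i ≡ false → oddb L ≡ false → i < L → suc i < L
even-<-step i L pi pL lt with m≤n⇒m<n∨m≡n lt
... | inj₁ l = l
... | inj₂ refl = ⊥-elim (true≢false (cong not pi) pL)

anyℕ : ℕ → (ℕ → Bool) → Bool
anyℕ zero p = false
anyℕ (suc k) p = p k ∨ anyℕ k p

anyℕ-intro : ∀ k (p : ℕ → Bool) i → i < k → p i ≡ true → anyℕ k p ≡ true
anyℕ-intro (suc k) p i lt e with m≤n⇒m<n∨m≡n (≤-pred lt)
... | inj₁ lt' = trans (cong (p k ∨_) (anyℕ-intro k p i lt' e)) (∨-zeroʳ (p k))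
... | inj₂ refl = cong (_∨ anyℕ i p) e

anyℕ-elim : ∀ k (p : ℕ → Bool) → anyℕ k p ≡ true → ∃ λ i → i < k × p i ≡ true
anyℕ-elim (suc k) p e with ∨-true {p k} e
... | inj₁ q = k , ≤-refl , q
... | inj₂ q = let (i , lt , r) = anyℕ-elim k p q in i , m≤n⇒m≤1+n lt , r

anyℕ-false : ∀ k (p : ℕ → Bool) → anyℕ k p ≡ false → ∀ i → i < k → p i ≡ false
anyℕ-false k p e i lt with p i in q
... | false = refl
... | true = ⊥-elim (true≢false (anyℕ-intro k p i lt q) e)

least-ℕ-from : (q : ℕ → Bool) → ∀ fuel i → (∀ j → j < i → q j ≡ false) → q (i + fuel) ≡ true →
  ∃ λ m → q m ≡ true × (∀ j → j < m → q j ≡ false)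
least-ℕ-from q fuel i below e with q i in qi
... | true = i , qi , below
least-ℕ-from q zero i below e | false = ⊥-elim (true≢false (subst (λ t → q t ≡ true) (+-identityʳ i) e) qi)
least-ℕ-from q (suc fuel) i below e | false = least-ℕ-from q fuel (suc i) below' (subst (λ t → q t ≡ true) (+-suc i fuel) e)
  where
  below' : ∀ j → j < suc i → q j ≡ false
  below' j lt with m≤n⇒m<n∨m≡n (≤-pred lt)
  ... | inj₁ l = below j l
  ... | inj₂ refl = qi

least-ℕ : (q : ℕ → Bool) → ∀ k → q k ≡ true → ∃ λ m → q m ≡ true × (∀ j → j < m → q j ≡ false)
least-ℕ q k e = least-ℕ-from q k 0 (λ j ()) e

find : ∀ {n} (p : Fin n → Bool) → Maybe (Fin n)
find {zero} p = nothing
find {suc n} p with p zero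
... | true = just zero
... | false with find (λ i → p (suc i))
... | just j = just (suc j)
... | nothing = nothing

find-just : ∀ {n} (p : Fin n → Bool) i → p i ≡ true → ∃ λ j → find p ≡ just j × p j ≡ true
find-just {suc n} p i e with p zero in e0
... | true = zero , refl , e0
find-just {suc n} p zero e | false = ⊥-elim (true≢false e e0)
find-just {suc n} p (suc i) e | false with find (λ i → p (suc i)) | find-just (λ i → p (suc i)) i e
... | just j | .j , refl , q = suc j , refl , q

rm : ∀ {n} → (Fin n → Bool) → Fin n → Fin n → Bool
rm X v x = X x ∧ not (eqb x v)

rm-⊆ : ∀ {n} {X : Fin n → Bool} {v x} → rm X v x ≡ true → X x ≡ true
rm-⊆ e = proj₁ (∧-true e)

rm-≢ : ∀ {n} {X : Fin n → Bool} {v x} → rm X v x ≡ true → ¬ x ≡ v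
rm-≢ {X = X} {v} {x} e eq rewrite eq | eqb-refl v = true≢false (proj₂ (∧-true {X v} e)) refl

rm-intro : ∀ {n} {X : Fin n → Bool} {v x} → X x ≡ true → ¬ x ≡ v → rm X v x ≡ true
rm-intro {v = v} {x} e ne rewrite e | eqb-false ne = refl

rm-out : ∀ {n} {X : Fin n → Bool} {v x} → X x ≡ false → rm X v x ≡ false
rm-out e rewrite e = refl

rm-self : ∀ {n} (X : Fin n → Bool) v → rm X v v ≡ false
rm-self X v rewrite eqb-refl v with X v
... | true = refl
... | false = refl

#-rm : ∀ {n} (X : Fin n → Bool) v → X v ≡ true → # X ≡ suc (# (rm X v))
#-rm X v xv = begin
  ∑ (λ x → bit (X x)) ≡⟨ ∑-cong pt ⟩
  ∑ (λ x → bit (eqb x v) + bit (rm X v x)) ≡⟨ ∑-+ (λ x → bit (eqb x v)) (λ x → bit (rm X v x)) ⟩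
  ∑ (λ x → bit (eqb x v)) + # (rm X v) ≡⟨ cong (_+ # (rm X v)) (trans (∑-single v z) (cong bit (eqb-refl v))) ⟩
  suc (# (rm X v)) ∎
  where
  open ≡-Reasoning
  pt : ∀ x → bit (X x) ≡ bit (eqb x v) + bit (rm X v x)
  pt x with x ≟ v
  ... | yes refl rewrite xv = refl
  ... | no ne with X x
  ... | true = refl
  ... | false = refl
  z : ∀ i → ¬ i ≡ v → bit (eqb i v) ≡ 0
  z i ne rewrite eqb-false ne = refl

rm2 : ∀ {n} → (Fin n → Bool) → Fin n → Fin n → Fin n → Bool
rm2 X v w = rm (rm X v) w

#-rm2 : ∀ {n} (X : Fin n → Bool) v w → X v ≡ true → X w ≡ true → ¬ w ≡ v → # X ≡ suc (suc (# (rm2 X v w)))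
#-rm2 X v w xv xw ne = trans (#-rm X v xv) (cong suc (#-rm (rm X v) w (rm-intro {X = X} {v} {w} xw ne)))

rm2-split : ∀ {n} (X : Fin n → Bool) v w → X v ≡ true → X w ≡ true → ∀ x → X x ≡ (rm2 X v w x ∨ (eqb x v ∨ eqb x w))
rm2-split X v w xv xw x = boolsplit (X x) (eqb x v) (eqb x w) (λ e → subst (λ q → X q ≡ true) (sym (eqb-true e)) xv) (λ e → subst (λ q → X q ≡ true) (sym (eqb-true e)) xw)
  where
  boolsplit : ∀ a b c → (b ≡ true → a ≡ true) → (c ≡ true → a ≡ true) → a ≡ ((a ∧ not b) ∧ not c) ∨ (b ∨ c)
  boolsplit true true c f g = refl
  boolsplit true false true f g = refl
  boolsplit true false false f g = refl
  boolsplit false true c f g = f refl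
  boolsplit false false true f g = g refl
  boolsplit false false false f g = refl

rm2-v : ∀ {n} (X : Fin n → Bool) v w → rm2 X v w v ≡ false
rm2-v X v w rewrite rm-self X v = refl

rm2-w : ∀ {n} (X : Fin n → Bool) v w → rm2 X v w w ≡ false
rm2-w X v w = rm-self (rm X v) w

rm-absent : ∀ {n} (A : Fin n → Bool) v → A v ≡ false → ∀ x → rm A v x ≡ A x
rm-absent A v av x with x ≟ v
... | yes refl rewrite av = refl
... | no _ = ∧-identityʳ (A x)

rm-comm : ∀ {n} (A : Fin n → Bool) a b x → rm (rm A a) b x ≡ rm (rm A b) a x
rm-comm A a b x with A x | eqb x a | eqb x b
... | true | true | true = refl
... | true | true | false = refl
... | true | false | true = refl
... | true | false | false = refl
... | false | _ | _ = refl

∧-rm2 : ∀ {n} (T Z : Fin n → Bool) v w x → (T x ∧ rm2 Z v w x) ≡ rm2 (λ y → T y ∧ Z y) v w x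
∧-rm2 T Z v w x with T x | Z x | eqb x v | eqb x w
... | true | b | c | d = refl
... | false | b | c | d = refl

rm2-∧ : ∀ {n} (T Z : Fin n → Bool) v w x → (rm2 Z v w x ∧ T x) ≡ rm2 (λ y → Z y ∧ T y) v w x
rm2-∧ T Z v w x = shuffle (T x) (Z x) (eqb x v) (eqb x w)
  where
  shuffle : ∀ t z c d → ((z ∧ not c) ∧ not d) ∧ t ≡ ((z ∧ t) ∧ not c) ∧ not d
  shuffle true true true d = refl
  shuffle false true true d = refl
  shuffle true true false true = refl
  shuffle false true false true = refl
  shuffle true true false false = refl
  shuffle false true false false = refl
  shuffle t false c d = refl

#-zero : ∀ {n} (X : Fin n → Bool) → # X ≡ 0 → ∀ x → X x ≡ false
#-zero X e x with X x in q
... | false = refl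
... | true = ⊥-elim (n≮0 (subst₂ _≤_ (cong bit q) e (∑-≥ {f = λ i → bit (X i)} x)))

#-pos : ∀ {n} (X : Fin n → Bool) → 0 < # X → ∃ λ v → X v ≡ true
#-pos X lt with ∑-pos {f = λ i → bit (X i)} lt
... | v , q with X v in e
... | true = v , e
... | false = ⊥-elim (n≮0 q)

pair : ∀ {n} → Fin n → Fin n → Fin n → Fin n → Bool
pair v w x y = (eqb x v ∧ eqb y w) ∨ (eqb x w ∧ eqb y v)

pair-elim : ∀ {n} (v w x y : Fin n) → pair v w x y ≡ true → (x ≡ v × y ≡ w) ⊎ (x ≡ w × y ≡ v)
pair-elim v w x y e with ∨-true {eqb x v ∧ eqb y w} e
... | inj₁ p = inj₁ (eqb-true (proj₁ (∧-true p)) , eqb-true (proj₂ (∧-true p)))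
... | inj₂ p = inj₂ (eqb-true (proj₁ (∧-true p)) , eqb-true (proj₂ (∧-true p)))

pair-vw : ∀ {n} (v w : Fin n) → pair v w v w ≡ true
pair-vw v w rewrite eqb-refl v | eqb-refl w = refl

pair-wv : ∀ {n} (v w : Fin n) → pair v w w v ≡ true
pair-wv v w rewrite eqb-refl v | eqb-refl w = ∨-zeroʳ (eqb w v ∧ eqb v w)

pair-sym-imp : ∀ {n} (v w x y : Fin n) → pair v w x y ≡ true → pair v w y x ≡ true
pair-sym-imp v w x y e with pair-elim v w x y e
... | inj₁ (refl , refl) = pair-wv v w
... | inj₂ (refl , refl) = pair-vw v w

pair-sym : ∀ {n} (v w x y : Fin n) → pair v w x y ≡ pair v w y x
pair-sym v w x y with pair v w x y in e1 | pair v w y x in e2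
... | true | true = refl
... | false | false = refl
... | true | false = ⊥-elim (true≢false (pair-sym-imp v w x y e1) e2)
... | false | true = ⊥-elim (true≢false (pair-sym-imp v w y x e2) e1)

-- Walks and connected components of induced subgraphs

module Walks {n : ℕ} (H : Graph n) where

  -- Vertex sets are Boolean predicates from here on; W is Walk from Defs in that encoding.
  data W (Y : Fin n → Bool) : Fin n → Fin n → Set where
    here : ∀ {u} → Y u ≡ true → W Y u u
    step : ∀ {u w v} → Y u ≡ true → adj H u w ≡ true → W Y w v → W Y u v

  W-start : ∀ {Y u v} → W Y u v → Y u ≡ true
  W-start (here p) = p
  W-start (step p _ _) = p

  W-end : ∀ {Y u v} → W Y u v → Y v ≡ true
  W-end (here p) = p
  W-end (step _ _ w) = W-end w

  W-app : ∀ {Y u v w} → W Y u v → W Y v w → W Y u w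
  W-app (here _) q = q
  W-app (step p a r) q = step p a (W-app r q)

  W-snoc : ∀ {Y u v w} → W Y u v → adj H v w ≡ true → Y w ≡ true → W Y u w
  W-snoc p a yw = W-app p (step (W-end p) a (here yw))

  W-rev : ∀ {Y u v} → W Y u v → W Y v u
  W-rev (here p) = here p
  W-rev (step p a r) = W-snoc (W-rev r) (trans (gsym H _ _) a) p

  W-mono : ∀ {Y Z u v} → (∀ x → Y x ≡ true → Z x ≡ true) → W Y u v → W Z u v
  W-mono s (here p) = here (s _ p)
  W-mono s (step p a r) = step (s _ p) a (W-mono s r)

  W-cross : ∀ {Y u v} (C : Fin n → Bool) → W Y u v → C u ≡ true → C v ≡ false →
            ∃ λ x → ∃ λ y → C x ≡ true × C y ≡ false × Y x ≡ true × Y y ≡ true × adj H x y ≡ true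
  W-cross C (here p) cu cv = ⊥-elim (true≢false cu cv)
  W-cross {Y} C (step {w = w} p a r) cu cv with C w in e
  ... | true = W-cross C r e cv
  ... | false = _ , w , cu , e , p , W-start r , a

  grow : (Y S : Fin n → Bool) → Fin n → Bool
  grow Y S x = S x ∨ (Y x ∧ anyF (λ y → S y ∧ adj H y x))

  iter : ℕ → (Y S : Fin n → Bool) → Fin n → Bool
  iter zero Y S = S
  iter (suc k) Y S = grow Y (iter k Y S)

  Closed : (Y S : Fin n → Bool) → Set
  Closed Y S = ∀ x y → S y ≡ true → Y x ≡ true → adj H y x ≡ true → S x ≡ true

  closed? : (Y S : Fin n → Bool) → Bool
  closed? Y S = allF (λ x → allF (λ y → not (S y ∧ (Y x ∧ adj H y x)) ∨ S x))

  closed?-true : ∀ Y S → closed? Y S ≡ true → Closed Y S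
  closed?-true Y S e x y sy yx a with allF-elim _ (allF-elim _ e x) y
  ... | q rewrite sy | yx | a = q

  closed?-false : ∀ Y S → closed? Y S ≡ false → ∃ λ x → ∃ λ y → S y ≡ true × Y x ≡ true × adj H y x ≡ true × S x ≡ false
  closed?-false Y S e with allF-false _ e
  ... | x , e2 with allF-false _ e2
  ... | y , e3 with S y in sy | Y x in yx | adj H y x in a | S x in sx
  ... | true | true | true | false = x , y , sy , yx , a , sx
  ... | true | true | true | true = ⊥-elim (true≢false refl e3)
  ... | true | true | false | _ = ⊥-elim (true≢false refl e3)
  ... | true | false | _ | _ = ⊥-elim (true≢false refl e3)
  ... | false | _ | _ | _ = ⊥-elim (true≢false refl e3)

  grow-⊇ : ∀ Y S x → S x ≡ true → grow Y S x ≡ true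
  grow-⊇ Y S x e rewrite e = refl

  grow-closed : ∀ Y S → Closed Y S → ∀ x → grow Y S x ≡ S x
  grow-closed Y S c x with S x in sx
  ... | true = refl
  ... | false with Y x in yx | anyF (λ y → S y ∧ adj H y x) in an
  ... | false | _ = refl
  ... | true | false = refl
  ... | true | true with anyF-elim _ an
  ... | y , q = ⊥-elim (true≢false (c x y (proj₁ (∧-true q)) yx (proj₂ (∧-true q))) sx)

  Closed-≐ : ∀ {Y S T} → (∀ x → S x ≡ T x) → Closed Y S → Closed Y T
  Closed-≐ {Y} {S} {T} eq c x y ty yx a = trans (sym (eq x)) (c x y (trans (eq y) ty) yx a)

  #-strict : ∀ (S T : Fin n → Bool) x → (∀ y → S y ≡ true → T y ≡ true) → S x ≡ false → T x ≡ true → suc (# S) ≤ # T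
  #-strict S T x sub sx tx = ∑-strict x (λ y → bit-mono (sub y)) (subst₂ (λ a b → bit a < bit b) (sym sx) (sym tx) (s≤s z≤n))

  iter-closed-or-grows : ∀ Y S k → Closed Y (iter k Y S) ⊎ k + # S ≤ # (iter k Y S)
  iter-closed-or-grows Y S zero = inj₂ ≤-refl
  iter-closed-or-grows Y S (suc k) with closed? Y (iter k Y S) in cb
  ... | true = inj₁ (Closed-≐ (λ x → sym (grow-closed Y _ (closed?-true Y _ cb) x)) (closed?-true Y _ cb))
  ... | false with closed?-false Y _ cb
  ... | x , y , sy , yx , a , sx with iter-closed-or-grows Y S k
  ... | inj₁ c = ⊥-elim (true≢false (c x y sy yx a) sx)
  ... | inj₂ le = inj₂ (≤-trans (s≤s le) (#-strict (iter k Y S) (iter (suc k) Y S) x (grow-⊇ Y _) sx fx))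
    where
    fx : grow Y (iter k Y S) x ≡ true
    fx rewrite sx | yx | anyF-intro (λ z → iter k Y S z ∧ adj H z x) y (∧-intro sy a) = refl

  iter-closed : ∀ Y S → 1 ≤ # S → Closed Y (iter n Y S)
  iter-closed Y S pos with iter-closed-or-grows Y S n
  ... | inj₁ c = c
  ... | inj₂ le = ⊥-elim (<-irrefl refl (≤-trans (≤-trans (subst (_≤ n + # S) (+-comm n 1) (+-monoʳ-≤ n pos)) le) (#≤n (iter n Y S))))

module Components {n : ℕ} (H : Graph n) where
  open Walks H

  -- K Y v is the vertex set of the component of v in H[Y] (empty if v ∉ Y): n rounds of
  -- growing {v} inside Y reach the whole component.
  K : (Y : Fin n → Bool) → Fin n → Fin n → Bool
  K Y v x = Y v ∧ iter n Y (eqb v) x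

  iter-walk : ∀ Y v k x → Y v ≡ true → iter k Y (eqb v) x ≡ true → W Y v x
  iter-walk Y v zero x yv e rewrite eqb-true {x = v} {x} e = here yv
  iter-walk Y v (suc k) x yv e with ∨-true e
  ... | inj₁ p = iter-walk Y v k x yv p
  ... | inj₂ p with ∧-true p
  ... | yx , an with anyF-elim _ an
  ... | y , q = W-snoc (iter-walk Y v k y yv (proj₁ (∧-true q))) (proj₂ (∧-true q)) yx

  iter-⊇ : ∀ Y S k x → S x ≡ true → iter k Y S x ≡ true
  iter-⊇ Y S zero x e = e
  iter-⊇ Y S (suc k) x e = grow-⊇ Y _ x (iter-⊇ Y S k x e)

  K-walk : ∀ {Y v x} → K Y v x ≡ true → W Y v x
  K-walk {Y} {v} {x} e = iter-walk Y v n x (proj₁ (∧-true e)) (proj₂ (∧-true e))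

  K-Y : ∀ {Y v x} → K Y v x ≡ true → Y x ≡ true
  K-Y e = W-end (K-walk e)

  K-Yv : ∀ {Y v x} → K Y v x ≡ true → Y v ≡ true
  K-Yv e = proj₁ (∧-true e)

  K-self : ∀ {Y v} → Y v ≡ true → K Y v v ≡ true
  K-self {Y} {v} yv = ∧-intro yv (iter-⊇ Y (eqb v) n v (eqb-refl v))

  #-singleton-pos : ∀ (v : Fin n) → 1 ≤ # (eqb v)
  #-singleton-pos v = ≤-trans (subst (1 ≤_) (cong bit (sym (eqb-refl v))) ≤-refl) (∑-≥ {f = λ i → bit (eqb v i)} v)

  K-closed : ∀ {Y v y x} → K Y v y ≡ true → Y x ≡ true → adj H y x ≡ true → K Y v x ≡ true
  K-closed {Y} {v} {y} {x} e yx a = ∧-intro (proj₁ (∧-true e)) (iter-closed Y (eqb v) (#-singleton-pos v) x y (proj₂ (∧-true e)) yx a)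

  walk-K-from : ∀ {Y v y x} → K Y v y ≡ true → W Y y x → K Y v x ≡ true
  walk-K-from e (here _) = e
  walk-K-from e (step _ a w) = walk-K-from (K-closed e (W-start w) a) w

  walk-K : ∀ {Y v x} → W Y v x → K Y v x ≡ true
  walk-K w = walk-K-from (K-self (W-start w)) w

  K-sym : ∀ {Y v x} → K Y v x ≡ true → K Y x v ≡ true
  K-sym e = walk-K (W-rev (K-walk e))

  K-trans : ∀ {Y v x y} → K Y v x ≡ true → K Y x y ≡ true → K Y v y ≡ true
  K-trans e f = walk-K (W-app (K-walk e) (K-walk f))

  K-eq : ∀ {Y v w} → K Y v w ≡ true → ∀ x → K Y v x ≡ K Y w x
  K-eq {Y} {v} {w} e x with K Y v x in e1 | K Y w x in e2
  ... | true | true = refl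
  ... | false | false = refl
  ... | true | false = ⊥-elim (true≢false (K-trans (K-sym e) e1) e2)
  ... | false | true = ⊥-elim (true≢false (K-trans e e2) e1)

  -- A component is represented by its least vertex, so oddc Y counts the odd components of H[Y].
  rep : (Y : Fin n → Bool) → Fin n → Bool
  rep Y r = Y r ∧ allF (λ x → not (ltb x r ∧ K Y r x))

  rep-Y : ∀ {Y r} → rep Y r ≡ true → Y r ≡ true
  rep-Y e = proj₁ (∧-true e)

  rep-min : ∀ {Y r x} → rep Y r ≡ true → K Y r x ≡ true → x Fin.< r → ⊥
  rep-min {Y} {r} {x} e k lt = not-∧ (allF-elim _ (proj₂ (∧-true e)) x) (ltb-true lt) k

  rep-unique : ∀ {Y r s x} → rep Y r ≡ true → rep Y s ≡ true → K Y r x ≡ true → K Y s x ≡ true → r ≡ s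
  rep-unique {Y} {r} {s} er es kr ks with FinP.<-cmp r s
  ... | tri≈ _ eq _ = eq
  ... | tri< lt _ _ = ⊥-elim (rep-min es (K-trans ks (K-sym kr)) lt)
  ... | tri> _ _ gt = ⊥-elim (rep-min er (K-trans kr (K-sym ks)) gt)

  rep-exists : ∀ {Y v} → Y v ≡ true → ∃ λ r → rep Y r ≡ true × K Y r v ≡ true
  rep-exists {Y} {v} yv with least (K Y v) v (K-self yv)
  ... | m , km , lt = m , ∧-intro (K-Y km) (allF-intro _ f) , K-sym km
    where
    f : ∀ x → not (ltb x m ∧ K Y m x) ≡ true
    f x with x Fin.<? m
    ... | no _ = refl
    ... | yes l rewrite sym (K-eq km x) | lt x l = refl

  oddRep : (Y : Fin n → Bool) → Fin n → Bool
  oddRep Y r = rep Y r ∧ oddb (# (K Y r))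

  oddc : (Y : Fin n → Bool) → ℕ
  oddc Y = # (oddRep Y)

  bit-∧ : ∀ a b → bit (a ∧ b) ≡ bit a * bit b
  bit-∧ true true = refl
  bit-∧ true false = refl
  bit-∧ false b = refl

  partition : ∀ Y Z → (∀ x → Z x ≡ true → Y x ≡ true) → (∀ x y → Z x ≡ true → K Y x y ≡ true → Z y ≡ true) →
    ∑ (λ r → bit (rep Y r ∧ Z r) * # (K Y r)) ≡ # Z
  partition Y Z zy zc = begin
    ∑ (λ r → bit (rep Y r ∧ Z r) * # (K Y r))
      ≡⟨ ∑-cong (λ r → sym (∑-*ˡ (bit (rep Y r ∧ Z r)) (λ x → bit (K Y r x)))) ⟩
    ∑ (λ r → ∑ (λ x → bit (rep Y r ∧ Z r) * bit (K Y r x)))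
      ≡⟨ ∑-cong (λ r → ∑-cong (λ x → sym (bit-∧ (rep Y r ∧ Z r) (K Y r x)))) ⟩
    ∑ (λ r → ∑ (λ x → bit ((rep Y r ∧ Z r) ∧ K Y r x)))
      ≡⟨ ∑-swap (λ r x → bit ((rep Y r ∧ Z r) ∧ K Y r x)) ⟩
    ∑ (λ x → ∑ (λ r → bit ((rep Y r ∧ Z r) ∧ K Y r x)))
      ≡⟨ ∑-cong inner ⟩
    # Z ∎
    where
    open ≡-Reasoning
    inner : ∀ x → ∑ (λ r → bit ((rep Y r ∧ Z r) ∧ K Y r x)) ≡ bit (Z x)
    inner x with Z x in zx
    ... | false = ∑-0 f
      where
      f : ∀ r → bit ((rep Y r ∧ Z r) ∧ K Y r x) ≡ 0
      f r with rep Y r ∧ Z r in e1 | K Y r x in e2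
      ... | false | _ = refl
      ... | true | false = refl
      ... | true | true = ⊥-elim (true≢false (zc r x (proj₂ (∧-true e1)) e2) zx)
    ... | true with rep-exists {Y} {x} (zy x zx)
    ... | r0 , rr0 , kr0 = trans (∑-single r0 f) g
      where
      zr0 : Z r0 ≡ true
      zr0 = zc x r0 zx (K-sym kr0)
      f : ∀ r → ¬ r ≡ r0 → bit ((rep Y r ∧ Z r) ∧ K Y r x) ≡ 0
      f r ne with rep Y r ∧ Z r in e1 | K Y r x in e2
      ... | false | _ = refl
      ... | true | false = refl
      ... | true | true = ⊥-elim (ne (rep-unique (proj₁ (∧-true e1)) rr0 e2 kr0))
      g : bit ((rep Y r0 ∧ Z r0) ∧ K Y r0 x) ≡ 1
      g rewrite rr0 | zr0 | kr0 = refl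

  oddb-bit* : ∀ b m → oddb (bit b * m) ≡ b ∧ oddb m
  oddb-bit* true m = cong oddb (+-identityʳ m)
  oddb-bit* false m = refl

  rep-∧Y : ∀ Y r → rep Y r ∧ Y r ≡ rep Y r
  rep-∧Y Y r with rep Y r in e
  ... | false = refl
  ... | true = rep-Y {Y} {r} e

  parity : ∀ Y → oddb (# Y) ≡ oddb (oddc Y)
  parity Y = begin
    oddb (# Y) ≡⟨ cong oddb (sym (partition Y Y (λ x e → e) (λ x y _ k → K-Y {Y} {x} {y} k))) ⟩
    oddb (∑ (λ r → bit (rep Y r ∧ Y r) * # (K Y r))) ≡⟨ ∑-oddb (λ r → bit (rep Y r ∧ Y r) * # (K Y r)) ⟩
    oddb (∑ (λ r → bit (oddb (bit (rep Y r ∧ Y r) * # (K Y r)))))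
      ≡⟨ cong oddb (∑-cong (λ r → cong bit (trans (oddb-bit* (rep Y r ∧ Y r) _) (cong (_∧ oddb (# (K Y r))) (rep-∧Y Y r))))) ⟩
    oddb (oddc Y) ∎
    where open ≡-Reasoning

  K-cong : ∀ {Y Y'} → (∀ x → Y x ≡ Y' x) → ∀ v x → K Y v x ≡ K Y' v x
  K-cong {Y} {Y'} e v x = bool-iff (λ k → walk-K (W-mono (λ y q → trans (sym (e y)) q) (K-walk {Y} {v} {x} k)))
                                   (λ k → walk-K (W-mono (λ y q → trans (e y) q) (K-walk {Y'} {v} {x} k)))

  rep-cong : ∀ {Y Y'} → (∀ x → Y x ≡ Y' x) → ∀ r → rep Y r ≡ rep Y' r
  rep-cong {Y} {Y'} e r = cong₂ _∧_ (e r) (allF-cong (λ x → cong (λ t → not (ltb x r ∧ t)) (K-cong e r x)))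

  oddc-cong : ∀ {Y Y'} → (∀ x → Y x ≡ Y' x) → oddc Y ≡ oddc Y'
  oddc-cong {Y} {Y'} e = ∑-cong (λ r → cong bit (cong₂ _∧_ (rep-cong e r) (cong oddb (#-cong (K-cong e r)))))

  module IsolatedVertex (Y Y' : Fin n → Bool) (u : Fin n) (yu : Y u ≡ true) (iso : ∀ v → adj H u v ≡ true → Y v ≡ false)
             (ye : ∀ x → Y' x ≡ (Y x ∧ not (eqb x u))) where

    avoid-u : ∀ {r x} → ¬ r ≡ u → W Y r x → W Y' r x
    avoid-u {r} ne (here p) = here (trans (ye r) (trans (cong (λ t → Y r ∧ not t) (eqb-false ne)) (trans (cong (_∧ true) p) refl)))
    avoid-u {r} ne (step {w = w} p a rest) = step (trans (ye r) (trans (cong (λ t → Y r ∧ not t) (eqb-false ne)) (trans (cong (_∧ true) p) refl)))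
      a (avoid-u w≢u rest)
      where
      w≢u : ¬ w ≡ u
      w≢u refl = true≢false p (iso r (trans (gsym H u r) a))

    K-u : ∀ x → K Y u x ≡ true → x ≡ u
    K-u x k = stuck (K-walk {Y} {u} {x} k)
      where
      stuck : ∀ {x} → W Y u x → x ≡ u
      stuck (here _) = refl
      stuck (step _ a rest) = ⊥-elim (true≢false (W-start rest) (iso _ a))

    Y′⊆Y : ∀ x → Y' x ≡ true → Y x ≡ true
    Y′⊆Y x e = proj₁ (∧-true {Y x} (trans (sym (ye x)) e))

    K≡K′ : ∀ r → ¬ r ≡ u → ∀ x → K Y r x ≡ K Y' r x
    K≡K′ r ne x = bool-iff (λ k → walk-K (avoid-u ne (K-walk {Y} {r} {x} k))) (λ k → walk-K (W-mono Y′⊆Y (K-walk {Y'} {r} {x} k)))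

    Y≡Y′ : ∀ r → ¬ r ≡ u → Y r ≡ Y' r
    Y≡Y′ r ne = sym (trans (ye r) (trans (cong (λ t → Y r ∧ not t) (eqb-false ne)) (∧-identityʳ (Y r))))

    oddc-remove-isolated : oddc Y ≡ suc (oddc Y')
    oddc-remove-isolated = ∑-except _ _ u at-u elsewhere
      where
      #K-u : # (K Y u) ≡ 1
      #K-u = trans (∑-single u (λ i ne → cong bit (K-u-only i ne))) (cong bit (K-self {Y} {u} yu))
        where
        K-u-only : ∀ i → ¬ i ≡ u → K Y u i ≡ false
        K-u-only i ne with K Y u i in k
        ... | false = refl
        ... | true = ⊥-elim (ne (K-u i k))
      rep-u : rep Y u ≡ true
      rep-u = ∧-intro yu (allF-intro _ (λ x → h x))
        where
        h : ∀ x → not (ltb x u ∧ K Y u x) ≡ true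
        h x with K Y u x in k
        ... | false = cong not (∧-zeroʳ (ltb x u))
        ... | true rewrite K-u x k = cong (λ t → not (t ∧ true)) (ltb-irr u)
          where
          ltb-irr : ∀ u → ltb u u ≡ false
          ltb-irr u with u Fin.<? u
          ... | yes lt = ⊥-elim (FinP.<-irrefl refl lt)
          ... | no _ = refl
      Y′-u : Y' u ≡ false
      Y′-u = trans (ye u) (trans (cong (λ t → Y u ∧ not t) (eqb-refl u)) (∧-zeroʳ (Y u)))
      at-u : bit (rep Y u ∧ oddb (# (K Y u))) ≡ suc (bit (rep Y' u ∧ oddb (# (K Y' u))))
      at-u rewrite rep-u | #K-u | Y′-u = refl
      elsewhere : ∀ r → ¬ r ≡ u → bit (rep Y r ∧ oddb (# (K Y r))) ≡ bit (rep Y' r ∧ oddb (# (K Y' r)))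
      elsewhere r ne = cong bit (cong₂ _∧_ (cong₂ _∧_ (Y≡Y′ r ne) (allF-cong (λ x → cong (λ t → not (ltb x r ∧ t)) (K≡K′ r ne x))))
                                    (cong oddb (#-cong (K≡K′ r ne))))

W-transfer : ∀ {n} (H H' : Graph n) → (∀ u v → adj H u v ≡ true → adj H' u v ≡ true) → ∀ {Y u v} →
  Walks.W H Y u v → Walks.W H' Y u v
W-transfer H H' s (Walks.here p) = Walks.here p
W-transfer H H' s (Walks.step p a w) = Walks.step p (s _ _ a) (W-transfer H H' s w)

-- An odd component of H′[Y] is a union of components of H[Y], at least one of them odd.
oddc-mono : ∀ {n} (H H' : Graph n) → (∀ u v → adj H u v ≡ true → adj H' u v ≡ true) → ∀ Y →
  Components.oddc H' Y ≤ Components.oddc H Y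
oddc-mono {n} H H' sub Y = #≤#-injection P Q R contains-odd R⇒Q injective
  where
  module C = Components H
  module C' = Components H'
  P : Fin n → Bool
  P = C'.oddRep Y
  Q : Fin n → Bool
  Q = C.oddRep Y
  R : Fin n → Fin n → Bool
  R r' r = P r' ∧ (Q r ∧ C'.K Y r' r)
  contains-odd : ∀ r' → P r' ≡ true → ∃ λ r → R r' r ≡ true
  contains-odd r' pr' with ∑-odd (λ r → bit (C.rep Y r ∧ Z r) * # (C.K Y r)) (trans (cong oddb (C.partition Y Z Z⊆Y Z-closed)) (proj₂ (∧-true {C'.rep Y r'} pr')))
    where
    Z : Fin n → Bool
    Z = C'.K Y r'
    Z⊆Y : ∀ x → Z x ≡ true → Y x ≡ true
    Z⊆Y x e = C'.K-Y {Y} {r'} {x} e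
    Z-closed : ∀ x y → Z x ≡ true → C.K Y x y ≡ true → Z y ≡ true
    Z-closed x y zx k = C'.walk-K-from {Y} {r'} {x} {y} zx (W-transfer H H' sub (C.K-walk {Y} {x} {y} k))
  ... | r , o = r , ∧-intro pr' (reorder (C.rep Y r) (C'.K Y r' r) (oddb (# (C.K Y r))) (trans (sym (C.oddb-bit* (C.rep Y r ∧ C'.K Y r' r) (# (C.K Y r)))) o))
    where
    reorder : ∀ a b c → (a ∧ b) ∧ c ≡ true → (a ∧ c) ∧ b ≡ true
    reorder true true true _ = refl
  R⇒Q : ∀ r' r → R r' r ≡ true → Q r ≡ true
  R⇒Q r' r e = proj₁ (∧-true {Q r} (proj₂ (∧-true {P r'} e)))
  injective : ∀ r1 r2 r → R r1 r ≡ true → R r2 r ≡ true → r1 ≡ r2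
  injective r1 r2 r e1 e2 = C'.rep-unique {Y} {r1} {r2} {r} (proj₁ (∧-true (proj₁ (∧-true {P r1} e1)))) (proj₁ (∧-true (proj₁ (∧-true {P r2} e2))))
    (proj₂ (∧-true {Q r} (proj₂ (∧-true {P r1} e1)))) (proj₂ (∧-true {Q r} (proj₂ (∧-true {P r2} e2))))

-- Perfect matchings

module Matchings {n : ℕ} (H : Graph n) where

  IsPM : (X : Fin n → Bool) → (Fin n → Fin n → Bool) → Set
  IsPM X M = (∀ u v → M u v ≡ M v u)
    × (∀ u v → M u v ≡ true → adj H u v ≡ true × X u ≡ true × X v ≡ true)
    × (∀ u → X u ≡ true → ∃ λ w → M u w ≡ true × (∀ w' → M u w' ≡ true → w' ≡ w))

  PM : (X : Fin n → Bool) → Set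
  PM X = Σ (Fin n → Fin n → Bool) (IsPM X)

  PM-≐ : ∀ {X Z} → (∀ x → X x ≡ Z x) → PM X → PM Z
  PM-≐ eq (M , s , e , p) = M , s , (λ u v m → let (a , b , c) = e u v m in a , trans (sym (eq u)) b , trans (sym (eq v)) c) ,
    (λ u zu → p u (trans (eq u) zu))

  PM-empty : ∀ {X} → (∀ x → X x ≡ false) → PM X
  PM-empty {X} f = (λ _ _ → false) , (λ _ _ → refl) , (λ _ _ ()) , (λ u xu → ⊥-elim (true≢false xu (f u)))

  PM-partner-unique : ∀ {X M} → IsPM X M → ∀ {u w w'} → M u w ≡ true → M u w' ≡ true → w ≡ w'
  PM-partner-unique {X} {M} (s , e , p) {u} {w} {w'} m m' with p u (proj₁ (proj₂ (e u w m)))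
  ... | z , _ , un = trans (un w m) (sym (un w' m'))

  PM-partner-injective : ∀ {X M} → IsPM X M → ∀ {u u' w} → M u w ≡ true → M u' w ≡ true → u ≡ u'
  PM-partner-injective {X} {M} pm@(s , e , p) {u} {u'} {w} m m' = PM-partner-unique pm (trans (s w u) m) (trans (s w u') m')

  PM-restrict : ∀ {X} v w → X v ≡ true → (pm : PM X) → proj₁ pm v w ≡ true → PM (rm (rm X v) w)
  PM-restrict {X} v w xv (M , s , e , p) mvw = M' , s' , e' , p'
    where
    X' : Fin n → Bool
    X' = rm2 X v w
    M' : Fin n → Fin n → Bool
    M' x y = M x y ∧ X' x ∧ X' y
    s' : ∀ x y → M' x y ≡ M' y x
    s' x y rewrite s x y with M y x
    ... | false = refl
    ... | true with X' x | X' y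
    ... | true | true = refl
    ... | true | false = refl
    ... | false | true = refl
    ... | false | false = refl
    e' : ∀ x y → M' x y ≡ true → adj H x y ≡ true × X' x ≡ true × X' y ≡ true
    e' x y m with ∧-true {M x y} m
    ... | mxy , r with ∧-true {X' x} r
    ... | a , b = proj₁ (e x y mxy) , a , b
    p' : ∀ x → X' x ≡ true → ∃ λ z → M' x z ≡ true × (∀ z' → M' x z' ≡ true → z' ≡ z)
    p' x x' with p x (rm-⊆ {X = X} {v} {x} (rm-⊆ {X = rm X v} {w} {x} x'))
    ... | z , mxz , un = z , ∧-intro mxz (∧-intro x' xz') , (λ z' m → un z' (proj₁ (∧-true m)))
      where
      pm : IsPM X M
      pm = (s , e , p)
      xz : X z ≡ true
      xz = proj₂ (proj₂ (e x z mxz))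
      xz' : X' z ≡ true
      xz' = rm-intro {X = rm X v} {w} {z} (rm-intro {X = X} {v} {z} xz nv) nw
        where
        nv : ¬ z ≡ v
        nv eq = rm-≢ {X = rm X v} {w} {x} x' (PM-partner-injective {X} {M} pm {x} {w} {v} (subst (λ q → M x q ≡ true) eq mxz) (trans (s w v) mvw))
        nw : ¬ z ≡ w
        nw eq = rm-≢ {X = X} {v} {x} (rm-⊆ {X = rm X v} {w} {x} x') (PM-partner-injective {X} {M} pm {x} {v} {w} (subst (λ q → M x q ≡ true) eq mxz) mvw)

  PM-union : ∀ {X A B} → (∀ x → X x ≡ (A x ∨ B x)) → (∀ x → A x ≡ true → B x ≡ true → ⊥) → PM A → PM B → PM X
  PM-union {X} {A} {B} xe disjoint (MA , sa , ea , pa) (MB , sb , eb , pb) = M , s' , e' , p'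
    where
    M : Fin n → Fin n → Bool
    M x y = MA x y ∨ MB x y
    s' : ∀ x y → M x y ≡ M y x
    s' x y = cong₂ _∨_ (sa x y) (sb x y)
    e' : ∀ x y → M x y ≡ true → adj H x y ≡ true × X x ≡ true × X y ≡ true
    e' x y q with ∨-true {MA x y} q
    ... | inj₁ m = let (a , b , c) = ea x y m in a , trans (xe x) (cong (_∨ B x) b) , trans (xe y) (cong (_∨ B y) c)
    ... | inj₂ m = let (a , b , c) = eb x y m in a , trans (xe x) (trans (cong (A x ∨_) b) (∨-zeroʳ (A x))) , trans (xe y) (trans (cong (A y ∨_) c) (∨-zeroʳ (A y)))
    p' : ∀ x → X x ≡ true → ∃ λ w → M x w ≡ true × (∀ w' → M x w' ≡ true → w' ≡ w)
    p' x xx with ∨-true {A x} (trans (sym (xe x)) xx)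
    ... | inj₁ ax with pa x ax
    ... | w , m , un = w , cong (_∨ MB x w) m , un'
      where
      un' : ∀ w' → M x w' ≡ true → w' ≡ w
      un' w' q with ∨-true {MA x w'} q
      ... | inj₁ q1 = un w' q1
      ... | inj₂ q2 = ⊥-elim (disjoint x ax (proj₁ (proj₂ (eb x w' q2))))
    p' x xx | inj₂ bx with pb x bx
    ... | w , m , un = w , trans (cong (MA x w ∨_) m) (∨-zeroʳ (MA x w)) , un'
      where
      un' : ∀ w' → M x w' ≡ true → w' ≡ w
      un' w' q with ∨-true {MA x w'} q
      ... | inj₁ q1 = ⊥-elim (disjoint x (proj₁ (proj₂ (ea x w' q1))) bx)
      ... | inj₂ q2 = un w' q2

  PM-edge : ∀ v w → ¬ v ≡ w → adj H v w ≡ true → PM (λ x → eqb x v ∨ eqb x w)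
  PM-edge v w v≢w v~w = pair v w , pair-sym v w , edges , partner
    where
    v∈ : eqb v v ∨ eqb v w ≡ true
    v∈ = cong (_∨ eqb v w) (eqb-refl v)
    w∈ : eqb w v ∨ eqb w w ≡ true
    w∈ = trans (cong (eqb w v ∨_) (eqb-refl w)) (∨-zeroʳ (eqb w v))
    edges : ∀ x y → pair v w x y ≡ true → adj H x y ≡ true × (eqb x v ∨ eqb x w) ≡ true × (eqb y v ∨ eqb y w) ≡ true
    edges x y e with pair-elim v w x y e
    ... | inj₁ (refl , refl) = v~w , v∈ , w∈
    ... | inj₂ (refl , refl) = trans (gsym H w v) v~w , w∈ , v∈
    partner : ∀ x → (eqb x v ∨ eqb x w) ≡ true → ∃ λ y → pair v w x y ≡ true × (∀ y′ → pair v w x y′ ≡ true → y′ ≡ y)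
    partner x e with ∨-true {eqb x v} e
    ... | inj₁ x≡v rewrite eqb-true x≡v = w , pair-vw v w , unique
      where
      unique : ∀ y′ → pair v w v y′ ≡ true → y′ ≡ w
      unique y′ e′ with pair-elim v w v y′ e′
      ... | inj₁ (_ , y′≡w) = y′≡w
      ... | inj₂ (v≡w , _) = ⊥-elim (v≢w v≡w)
    ... | inj₂ x≡w rewrite eqb-true x≡w = v , pair-wv v w , unique
      where
      unique : ∀ y′ → pair v w w y′ ≡ true → y′ ≡ v
      unique y′ e′ with pair-elim v w w y′ e′
      ... | inj₁ (w≡v , _) = ⊥-elim (v≢w (sym w≡v))
      ... | inj₂ (_ , y′≡v) = y′≡v

  PM-extend : ∀ {X X′} v w → (∀ x → X x ≡ (X′ x ∨ (eqb x v ∨ eqb x w))) → X′ v ≡ false → X′ w ≡ false → ¬ v ≡ w →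
    adj H v w ≡ true → PM X′ → PM X
  PM-extend {X} {X′} v w split v∉ w∉ v≢w v~w pm = PM-union split disjoint pm (PM-edge v w v≢w v~w)
    where
    disjoint : ∀ x → X′ x ≡ true → (eqb x v ∨ eqb x w) ≡ true → ⊥
    disjoint x x∈ e with ∨-true {eqb x v} e
    ... | inj₁ x≡v = true≢false x∈ (subst (λ y → X′ y ≡ false) (sym (eqb-true x≡v)) v∉)
    ... | inj₂ x≡w = true≢false x∈ (subst (λ y → X′ y ≡ false) (sym (eqb-true x≡w)) w∉)

  adj⇒≢ : ∀ {v w} → adj H v w ≡ true → ¬ w ≡ v
  adj⇒≢ {v} a refl = true≢false a (loopless H v)

  PM-even′ : ∀ k X → # X ≤ k → PM X → oddb (# X) ≡ false
  PM-even′ k X le pm with # X in e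
  ... | zero = refl
  PM-even′ (suc k) X le pm@(M , s , ed , p) | suc m with #-pos X (subst (0 <_) (sym e) (s≤s z≤n))
  ... | v , xv with p v xv
  ... | w , mvw , _ with ed v w mvw
  ... | a , _ , xw = trans (cong oddb (trans (sym e) eq)) (cong (λ b → not (not b)) ih)
    where
    eq : # X ≡ suc (suc (# (rm2 X v w)))
    eq = #-rm2 X v w xv xw (adj⇒≢ a)
    bound : # (rm2 X v w) ≤ k
    bound = ≤-trans (n≤1+n _) (≤-pred (subst (_≤ suc k) (trans (sym e) eq) le))
    ih : oddb (# (rm2 X v w)) ≡ false
    ih = PM-even′ k (rm2 X v w) bound (PM-restrict v w xv pm mvw)

  PM-even : ∀ X → PM X → oddb (# X) ≡ false
  PM-even X = PM-even′ (# X) X ≤-refl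

  MatchableWith : (X : Fin n → Bool) → Fin n → Fin n → Set
  MatchableWith X v w = X w ≡ true × adj H v w ≡ true × PM (rm2 X v w)

  PM-dec′ : ∀ k X → # X ≤ k → Dec (PM X)
  PM-dec′ k X le with # X in e
  ... | zero = yes (PM-empty (#-zero X e))
  PM-dec′ (suc k) X le | suc m with #-pos X (subst (0 <_) (sym e) (s≤s z≤n))
  ... | v , xv with FinP.any? matchable?
    where
    matchable? : ∀ w → Dec (MatchableWith X v w)
    matchable? w with X w in xw | adj H v w in a
    ... | false | _ = no (λ c → true≢false (proj₁ c) refl)
    ... | true | false = no (λ c → true≢false (proj₁ (proj₂ c)) refl)
    ... | true | true with PM-dec′ k (rm2 X v w) bound
      where
      eq : # X ≡ suc (suc (# (rm2 X v w)))
      eq = #-rm2 X v w xv xw (adj⇒≢ a)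
      bound : # (rm2 X v w) ≤ k
      bound = ≤-trans (n≤1+n _) (≤-pred (subst (_≤ suc k) (trans (sym e) eq) le))
    ... | yes pm = yes (refl , refl , pm)
    ... | no npm = no (λ c → npm (proj₂ (proj₂ c)))
  ... | yes (w , xw , a , pm) = yes (PM-extend v w (rm2-split X v w xv xw) (rm2-v X v w) (rm2-w X v w) (λ q → adj⇒≢ a (sym q)) a pm)
  ... | no nc = no λ where
    pm@(M , s , ed , p) → let (w , mvw , _) = p v xv in
      nc (w , proj₂ (proj₂ (ed v w mvw)) , proj₁ (ed v w mvw) , PM-restrict v w xv pm mvw)

  PM-dec : ∀ X → Dec (PM X)
  PM-dec X = PM-dec′ (# X) X ≤-refl

module _ {n : ℕ} (H : Graph n) where
  open Matchings H

  PM-restrict-closed : ∀ (H' : Graph n) {X A M} → Matchings.IsPM H' X M → (∀ x → A x ≡ true → X x ≡ true) →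
    (∀ x y → A x ≡ true → M x y ≡ true → A y ≡ true) → (∀ x y → A x ≡ true → M x y ≡ true → adj H x y ≡ true) → PM A
  PM-restrict-closed H' {X} {A} {M} (s , e , p) ax cl ed = MA , s' , e' , p'
    where
    MA : Fin n → Fin n → Bool
    MA x y = M x y ∧ A x
    s' : ∀ x y → MA x y ≡ MA y x
    s' x y rewrite s x y with M y x in m
    ... | false = refl
    ... | true with A x in ax' | A y in ay
    ... | true | true = refl
    ... | false | false = refl
    ... | true | false = ⊥-elim (true≢false (cl x y ax' (trans (s x y) m)) ay)
    ... | false | true = ⊥-elim (true≢false (cl y x ay m) ax')
    e' : ∀ x y → MA x y ≡ true → adj H x y ≡ true × A x ≡ true × A y ≡ true
    e' x y q with ∧-true {M x y} q
    ... | m , a = ed x y a m , a , cl x y a m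
    p' : ∀ x → A x ≡ true → ∃ λ w → MA x w ≡ true × (∀ w' → MA x w' ≡ true → w' ≡ w)
    p' x a with p x (ax x a)
    ... | w , m , un = w , ∧-intro m a , (λ w' q → un w' (proj₁ (∧-true {M x w'} q)))

module _ {n : ℕ} (H : Graph n) where
  open Components H
  open Matchings H

  -- Each odd component of X − S has a vertex matched into S, and distinct components use distinct vertices of S.
  tutte-easy : ∀ X S → PM X → (∀ x → S x ≡ true → X x ≡ true) → oddc (λ x → X x ∧ not (S x)) ≤ # S
  tutte-easy X S (M , pm) sx = #≤#-injection (oddRep Y) S R matched-out R⇒S injective
    where
    Y : Fin n → Bool
    Y x = X x ∧ not (S x)
    R : Fin n → Fin n → Bool
    R r s = oddRep Y r ∧ (S s ∧ anyF (λ x → K Y r x ∧ M x s))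
    matched-out : ∀ r → oddRep Y r ≡ true → ∃ λ s → R r s ≡ true
    matched-out r pr with anyF (λ x → K Y r x ∧ anyF (λ y → M x y ∧ not (K Y r y))) in q
    ... | true with anyF-elim _ q
    ... | x , q1 with ∧-true {K Y r x} q1
    ... | krx , q2 with anyF-elim _ q2
    ... | y , q3 with ∧-true {M x y} q3
    ... | mxy , nk = y , ∧-intro pr (∧-intro sy (anyF-intro (λ x → K Y r x ∧ M x y) x (∧-intro krx mxy)))
      where
      ed : adj H x y ≡ true × X x ≡ true × X y ≡ true
      ed = proj₁ (proj₂ pm) x y mxy
      sy : S y ≡ true
      sy with S y in e
      ... | true = refl
      ... | false = ⊥-elim (true≢false (K-closed {Y} {r} {x} {y} krx (∧-intro (proj₂ (proj₂ ed)) (cong not e)) (proj₁ ed)) (trans (sym (not-involutive (K Y r y))) (cong not nk)))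
    matched-out r pr | false = ⊥-elim (true≢false (proj₂ (∧-true {rep Y r} pr)) (PM-even (K Y r) pmK))
      where
      cl : ∀ x y → K Y r x ≡ true → M x y ≡ true → K Y r y ≡ true
      cl x y kx m with K Y r y in ky
      ... | true = refl
      ... | false = ⊥-elim (true≢false (anyF-intro _ x (∧-intro kx (anyF-intro (λ y → M x y ∧ not (K Y r y)) y (∧-intro m (cong not ky))))) q)
      pmK : PM (K Y r)
      pmK = PM-restrict-closed H H pm (λ x k → proj₁ (∧-true {X x} (K-Y {Y} {r} {x} k))) cl (λ x y _ m → proj₁ (proj₁ (proj₂ pm) x y m))
    R⇒S : ∀ r s → R r s ≡ true → S s ≡ true
    R⇒S r s e = proj₁ (∧-true {S s} (proj₂ (∧-true {oddRep Y r} e)))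
    injective : ∀ r1 r2 s → R r1 s ≡ true → R r2 s ≡ true → r1 ≡ r2
    injective r1 r2 s e1 e2 with anyF-elim _ (proj₂ (∧-true {S s} (proj₂ (∧-true {oddRep Y r1} e1)))) | anyF-elim _ (proj₂ (∧-true {S s} (proj₂ (∧-true {oddRep Y r2} e2))))
    ... | x1 , q1 | x2 , q2 = rep-unique {Y} {r1} {r2} {x1} (proj₁ (∧-true {rep Y r1} (proj₁ (∧-true {oddRep Y r1} e1)))) (proj₁ (∧-true {rep Y r2} (proj₁ (∧-true {oddRep Y r2} e2))))
        (proj₁ (∧-true {K Y r1 x1} q1)) (subst (λ t → K Y r2 t ≡ true) (sym x12) (proj₁ (∧-true {K Y r2 x2} q2)))
      where
      x12 : x1 ≡ x2
      x12 = PM-partner-injective {X} {M} pm (proj₂ (∧-true {K Y r1 x1} q1)) (proj₂ (∧-true {K Y r2 x2} q2))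

complement-closed : ∀ {n} (H' : Graph n) {X A : Fin n → Bool} {M : Fin n → Fin n → Bool} → Matchings.IsPM H' X M → (∀ x y → A x ≡ true → M x y ≡ true → A y ≡ true) →
  ∀ x y → (X x ∧ not (A x)) ≡ true → M x y ≡ true → (X y ∧ not (A y)) ≡ true
complement-closed H' {X} {A} {M} (s , e , p) cl x y b m = help (A y) refl
  where
  help : ∀ t → A y ≡ t → (X y ∧ not (A y)) ≡ true
  help true ay = ⊥-elim (true≢false (cl y x ay (trans (s y x) m)) (trans (sym (not-involutive (A x))) (cong not (proj₂ (∧-true {X x} {not (A x)} b)))))
  help false ay rewrite ay = ∧-intro (proj₂ (proj₂ (e x y m))) refl

-- Tutte's theorem

addEdge : ∀ {n} → Graph n → Fin n → Fin n → Graph n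
addEdge H a c = record
  { adj = λ u v → adj H u v ∨ (pair a c u v ∧ not (eqb u v))
  ; sym = λ u v → cong₂ _∨_ (gsym H u v) (cong₂ _∧_ (pair-sym a c u v) (cong not (eqb-sym u v)))
  ; loopless = λ u → trans (cong₂ _∨_ (loopless H u) (cong (λ b → pair a c u u ∧ not b) (eqb-refl u))) (∧-zeroʳ (pair a c u u))
  }

addEdge-⊇ : ∀ {n} (H : Graph n) a c u v → adj H u v ≡ true → adj (addEdge H a c) u v ≡ true
addEdge-⊇ H a c u v e rewrite e = refl

addEdge-new : ∀ {n} (H : Graph n) a c → ¬ a ≡ c → adj (addEdge H a c) a c ≡ true
addEdge-new H a c ne rewrite pair-vw a c | eqb-false ne = ∨-zeroʳ (adj H a c)

addEdge-elim : ∀ {n} (H : Graph n) a c u v → adj (addEdge H a c) u v ≡ true → adj H u v ≡ true ⊎ ((u ≡ a × v ≡ c) ⊎ (u ≡ c × v ≡ a))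
addEdge-elim H a c u v e with ∨-true {adj H u v} e
... | inj₁ p = inj₁ p
... | inj₂ p = inj₂ (pair-elim a c u v (proj₁ (∧-true p)))

nonEdges : ∀ {n} → Graph n → (Fin n → Bool) → ℕ
nonEdges H X = ∑ (λ u → ∑ (λ v → bit (X u ∧ X v ∧ not (eqb u v) ∧ not (adj H u v))))

nonEdges-add : ∀ {n} (H : Graph n) X a c → X a ≡ true → X c ≡ true → ¬ a ≡ c → adj H a c ≡ false → suc (nonEdges (addEdge H a c) X) ≤ nonEdges H X
nonEdges-add H X a c xa xc ne nac = ∑-strict a (λ u → ∑-mono (λ v → bit-mono (le u v))) (∑-strict c (λ v → bit-mono (le a v)) lt)
  where
  le : ∀ u v → (X u ∧ X v ∧ not (eqb u v) ∧ not (adj (addEdge H a c) u v)) ≡ true → (X u ∧ X v ∧ not (eqb u v) ∧ not (adj H u v)) ≡ true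
  le u v e = weaken (X u) (X v) (not (eqb u v)) (adj H u v) (adj (addEdge H a c) u v) (addEdge-⊇ H a c u v) e
    where
    weaken : ∀ a b c s s' → (s ≡ true → s' ≡ true) → a ∧ b ∧ c ∧ not s' ≡ true → a ∧ b ∧ c ∧ not s ≡ true
    weaken true true true false s' f e = refl
    weaken true true true true s' f e rewrite f refl = e
    weaken true true false s s' f ()
    weaken true false c s s' f ()
    weaken false b c s s' f ()
  lt : bit (X a ∧ X c ∧ not (eqb a c) ∧ not (adj (addEdge H a c) a c)) < bit (X a ∧ X c ∧ not (eqb a c) ∧ not (adj H a c))
  lt = subst₂ (λ p q → bit (X a ∧ X c ∧ not (eqb a c) ∧ not p) < bit (X a ∧ X c ∧ not (eqb a c) ∧ not q)) (sym (addEdge-new H a c ne)) (sym nac) lt0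
    where
    lt0 : bit (X a ∧ X c ∧ not (eqb a c) ∧ false) < bit (X a ∧ X c ∧ not (eqb a c) ∧ true)
    lt0 rewrite xa | xc | eqb-false ne = s≤s z≤n

-- A set Z ⊆ X of
-- even size such that at most |Z ∩ S| components of X − S meet Z in an odd number of vertices has a
-- perfect matching: match a vertex of an odd part into S, or a vertex of an even part inside its part.
module CompleteComponents {n : ℕ} (H : Graph n) (X S : Fin n → Bool)
  (S-adjacent : ∀ s x → S s ≡ true → X x ≡ true → ¬ x ≡ s → adj H s x ≡ true)
  (complete : ∀ v w → Components.K H (λ x → X x ∧ not (S x)) v w ≡ true → ¬ v ≡ w → adj H v w ≡ true) where
  open Matchings H
  open Components H

  Y : Fin n → Bool
  Y x = X x ∧ not (S x)

  KZ : (Fin n → Bool) → Fin n → Fin n → Bool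
  KZ Z r x = K Y r x ∧ Z x

  oddParts : (Fin n → Bool) → ℕ
  oddParts Z = # (λ r → rep Y r ∧ oddb (# (KZ Z r)))

  #S∩ : (Fin n → Bool) → ℕ
  #S∩ Z = # (λ x → Z x ∧ S x)

  Y⇒¬S : ∀ {x} → Y x ≡ true → S x ≡ false
  Y⇒¬S {x} e with S x in q
  ... | false = refl
  ... | true = ⊥-elim (true≢false (proj₂ (∧-true {X x} e)) refl)

  S⇒¬K : ∀ r x → S x ≡ true → K Y r x ≡ false
  S⇒¬K r x sx with K Y r x in k
  ... | false = refl
  ... | true = ⊥-elim (true≢false (proj₂ (∧-true {X x} (K-Y {Y} {r} {x} k))) (cong not sx))

  KZ-rm2-outside : ∀ Z r v w → K Y r v ≡ false → K Y r w ≡ false → ∀ x → KZ (rm2 Z v w) r x ≡ KZ Z r x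
  KZ-rm2-outside Z r v w kv kw x = trans (∧-rm2 (K Y r) Z v w x)
    (trans (rm-absent (rm (KZ Z r) v) w (trans (rm-absent (KZ Z r) v (cong (_∧ Z v) kv) w) (cong (_∧ Z w) kw)) x)
      (rm-absent (KZ Z r) v (cong (_∧ Z v) kv) x))

  KZ-rm2-one : ∀ Z r v w → K Y r w ≡ false → ∀ x → KZ (rm2 Z v w) r x ≡ rm (KZ Z r) v x
  KZ-rm2-one Z r v w kw x = trans (∧-rm2 (K Y r) Z v w x)
    (rm-absent (rm (KZ Z r) v) w (rm-out {X = KZ Z r} {v} {w} (cong (_∧ Z w) kw)) x)

  #S∩-rm2-outside : ∀ Z v w → S v ≡ false → S w ≡ false → #S∩ (rm2 Z v w) ≡ #S∩ Z
  #S∩-rm2-outside Z v w sv sw = #-cong (λ x → trans (rm2-∧ S Z v w x)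
    (trans (rm-absent (rm Z∩S v) w (trans (rm-absent Z∩S v Z∩S-v w) Z∩S-w) x) (rm-absent Z∩S v Z∩S-v x)))
    where
    Z∩S : Fin n → Bool
    Z∩S y = Z y ∧ S y
    Z∩S-v : Z∩S v ≡ false
    Z∩S-v = trans (cong (Z v ∧_) sv) (∧-zeroʳ (Z v))
    Z∩S-w : Z∩S w ≡ false
    Z∩S-w = trans (cong (Z w ∧_) sw) (∧-zeroʳ (Z w))

  #S∩-rm2-one : ∀ Z v s → S v ≡ false → Z s ≡ true → S s ≡ true → #S∩ Z ≡ suc (#S∩ (rm2 Z v s))
  #S∩-rm2-one Z v s sv zs ss = trans (#-rm Z∩S s (∧-intro zs ss))
    (cong suc (#-cong (λ x → trans (sym (rm-absent (rm Z∩S s) v (rm-out {X = Z∩S} {s} {v} Z∩S-v) x))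
      (trans (rm-comm Z∩S s v x) (sym (rm2-∧ S Z v s x))))))
    where
    Z∩S : Fin n → Bool
    Z∩S y = Z y ∧ S y
    Z∩S-v : Z∩S v ≡ false
    Z∩S-v = trans (cong (Z v ∧_) sv) (∧-zeroʳ (Z v))

  Good : (Fin n → Bool) → Set
  Good Z = (∀ x → Z x ≡ true → X x ≡ true) × oddb (# Z) ≡ false × oddParts Z ≤ #S∩ Z

  module Step (k : ℕ) (ih : ∀ Z → # Z ≤ k → Good Z → PM Z) (Z : Fin n → Bool) (m : ℕ) (#Z≡ : # Z ≡ suc m)
              (size : suc m ≤ suc k) (Z⊆X : ∀ x → Z x ≡ true → X x ≡ true) (even : oddb (suc m) ≡ false)
              (inv : oddParts Z ≤ #S∩ Z) where

    match : ∀ v w → Z v ≡ true → Z w ≡ true → ¬ v ≡ w → adj H v w ≡ true →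
      oddParts (rm2 Z v w) ≤ #S∩ (rm2 Z v w) → PM Z
    match v w zv zw v≢w v~w inv' = PM-extend v w (rm2-split Z v w zv zw) (rm2-v Z v w) (rm2-w Z v w) v≢w v~w
      (ih (rm2 Z v w) bound ((λ x q → Z⊆X x (rm-⊆ {X = Z} {v} {x} (rm-⊆ {X = rm Z v} {w} {x} q))) , even' , inv'))
      where
      #Z≡2+ : suc m ≡ suc (suc (# (rm2 Z v w)))
      #Z≡2+ = trans (sym #Z≡) (#-rm2 Z v w zv zw (λ q → v≢w (sym q)))
      bound : # (rm2 Z v w) ≤ k
      bound = ≤-trans (n≤1+n _) (≤-pred (subst (_≤ suc k) #Z≡2+ size))
      even' : oddb (# (rm2 Z v w)) ≡ false
      even' = trans (sym (not-involutive (oddb (# (rm2 Z v w))))) (trans (cong oddb (sym #Z≡2+)) even)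

    inside-S : (∀ x → (Z x ∧ not (S x)) ≡ false) → PM Z
    inside-S ⊆S with #-pos Z (subst (0 <_) (sym #Z≡) (s≤s z≤n))
    ... | v , zv with #-pos (rm Z v) (odd⇒pos (subst (λ t → oddb t ≡ true) m≡ (not≡false even)))
      where
      m≡ : m ≡ # (rm Z v)
      m≡ = suc-injective (trans (sym #Z≡) (#-rm Z v zv))
    ... | w , mw = match v w zv zw (λ q → rm-≢ {X = Z} {v} {w} mw (sym q))
                     (S-adjacent v w (Z⇒S v zv) (Z⊆X w zw) (rm-≢ {X = Z} {v} {w} mw))
                     (subst (_≤ #S∩ (rm2 Z v w)) (sym no-parts) z≤n)
      where
      zw : Z w ≡ true
      zw = rm-⊆ {X = Z} {v} {w} mw
      Z⇒S : ∀ x → Z x ≡ true → S x ≡ true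
      Z⇒S x zx with S x in q
      ... | true = refl
      ... | false = ⊥-elim (true≢false (∧-intro {Z x} {not (S x)} zx (cong not q)) (⊆S x))
      no-parts : oddParts (rm2 Z v w) ≡ 0
      no-parts = ∑-0 (λ r → trans (cong (λ t → bit (rep Y r ∧ oddb t)) (∑-0 (λ x → cong bit (KZ≡false r x)))) (cong bit (∧-zeroʳ (rep Y r))))
        where
        KZ≡false : ∀ r x → KZ (rm2 Z v w) r x ≡ false
        KZ≡false r x with rm2 Z v w x in q
        ... | false = ∧-zeroʳ (K Y r x)
        ... | true rewrite S⇒¬K r x (Z⇒S x (rm-⊆ {X = Z} {v} {x} (rm-⊆ {X = rm Z v} {w} {x} q))) = refl

    module Part (v r : Fin n) (zv : Z v ≡ true) (sv : S v ≡ false) (rep-r : rep Y r ≡ true) (Krv : K Y r v ≡ true) where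

      #KZ≡ : # (KZ Z r) ≡ suc (# (rm (KZ Z r) v))
      #KZ≡ = #-rm (KZ Z r) v (∧-intro Krv zv)

      other-part : ∀ r' x → rep Y r' ≡ true → K Y r x ≡ true → ¬ r' ≡ r → K Y r' x ≡ false
      other-part r' x rep-r' Krx r'≢r with K Y r' x in e
      ... | false = refl
      ... | true = ⊥-elim (r'≢r (rep-unique {Y} {r'} {r} {x} rep-r' rep-r e Krx))

      odd-part : oddb (# (KZ Z r)) ≡ true → PM Z
      odd-part o = match v s zv zs v≢s v~s (≤-pred (subst₂ _≤_ parts≡ #S∩≡ inv))
        where
        some-part : 1 ≤ oddParts Z
        some-part = ≤-trans (subst (λ t → 1 ≤ bit (t ∧ oddb (# (KZ Z r)))) (sym rep-r) (subst (λ t → 1 ≤ bit t) (sym o) ≤-refl))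
                      (∑-≥ {f = λ r → bit (rep Y r ∧ oddb (# (KZ Z r)))} r)
        s∈Z∩S : ∃ λ s → (Z s ∧ S s) ≡ true
        s∈Z∩S = #-pos (λ y → Z y ∧ S y) (≤-trans some-part inv)
        s : Fin n
        s = proj₁ s∈Z∩S
        zs : Z s ≡ true
        zs = proj₁ (∧-true {Z s} (proj₂ s∈Z∩S))
        ss : S s ≡ true
        ss = proj₂ (∧-true {Z s} (proj₂ s∈Z∩S))
        v≢s : ¬ v ≡ s
        v≢s v≡s = true≢false ss (trans (cong S (sym v≡s)) sv)
        v~s : adj H v s ≡ true
        v~s = trans (gsym H v s) (S-adjacent s v ss (Z⊆X v zv) v≢s)
        rest-even : oddb (# (rm (KZ Z r) v)) ≡ false
        rest-even with oddb (# (rm (KZ Z r) v)) in t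
        ... | false = refl
        ... | true = ⊥-elim (true≢false o (trans (cong oddb #KZ≡) (cong not t)))
        parts≡ : oddParts Z ≡ suc (oddParts (rm2 Z v s))
        parts≡ = ∑-except (λ r → bit (rep Y r ∧ oddb (# (KZ Z r)))) (λ r → bit (rep Y r ∧ oddb (# (KZ (rm2 Z v s) r)))) r at-r elsewhere
          where
          at-r : bit (rep Y r ∧ oddb (# (KZ Z r))) ≡ suc (bit (rep Y r ∧ oddb (# (KZ (rm2 Z v s) r))))
          at-r = trans (cong₂ (λ a b → bit (a ∧ b)) rep-r o) (cong (λ t → suc (bit t)) (sym now-even))
            where
            now-even : rep Y r ∧ oddb (# (KZ (rm2 Z v s) r)) ≡ false
            now-even = cong₂ _∧_ rep-r (trans (cong oddb (#-cong (KZ-rm2-one Z r v s (S⇒¬K r s ss)))) rest-even)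
          elsewhere : ∀ r' → ¬ r' ≡ r → bit (rep Y r' ∧ oddb (# (KZ Z r'))) ≡ bit (rep Y r' ∧ oddb (# (KZ (rm2 Z v s) r')))
          elsewhere r' r'≢r with rep Y r' in e
          ... | false = refl
          ... | true = cong (λ t → bit (true ∧ oddb t)) (sym (#-cong (KZ-rm2-outside Z r' v s (other-part r' v e Krv r'≢r) (S⇒¬K r' s ss))))
        #S∩≡ : #S∩ Z ≡ suc (#S∩ (rm2 Z v s))
        #S∩≡ = #S∩-rm2-one Z v s sv zs ss

      even-part : oddb (# (KZ Z r)) ≡ false → PM Z
      even-part o = match v w zv zw v≢w v~w (subst₂ _≤_ (sym parts≡) (sym #S∩≡) inv)
        where
        rest-odd : oddb (# (rm (KZ Z r) v)) ≡ true
        rest-odd = not≡false (trans (cong oddb (sym #KZ≡)) o)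
        w∈rest : ∃ λ w → rm (KZ Z r) v w ≡ true
        w∈rest = #-pos (rm (KZ Z r) v) (odd⇒pos rest-odd)
        w : Fin n
        w = proj₁ w∈rest
        KZw : KZ Z r w ≡ true
        KZw = rm-⊆ {X = KZ Z r} {v} {w} (proj₂ w∈rest)
        Krw : K Y r w ≡ true
        Krw = proj₁ (∧-true {K Y r w} KZw)
        zw : Z w ≡ true
        zw = proj₂ (∧-true {K Y r w} KZw)
        w≢v : ¬ w ≡ v
        w≢v = rm-≢ {X = KZ Z r} {v} {w} (proj₂ w∈rest)
        v≢w : ¬ v ≡ w
        v≢w v≡w = w≢v (sym v≡w)
        v~w : adj H v w ≡ true
        v~w = complete v w (K-trans {Y} {v} {r} {w} (K-sym {Y} {r} {v} Krv) Krw) v≢w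
        parts≡ : oddParts (rm2 Z v w) ≡ oddParts Z
        parts≡ = ∑-cong same
          where
          same : ∀ r' → bit (rep Y r' ∧ oddb (# (KZ (rm2 Z v w) r'))) ≡ bit (rep Y r' ∧ oddb (# (KZ Z r')))
          same r' with r' ≟ r
          ... | yes refl = cong (λ t → bit (rep Y r' ∧ t)) (trans (cong oddb (#-cong (∧-rm2 (K Y r') Z v w)))
                  (trans (sym (not-involutive _)) (cong oddb (sym (#-rm2 (KZ Z r') v w (∧-intro Krv zv) KZw w≢v)))))
          ... | no r'≢r with rep Y r' in e
          ...   | false = refl
          ...   | true = cong (λ t → bit (true ∧ oddb t)) (#-cong (KZ-rm2-outside Z r' v w (other-part r' v e Krv r'≢r) (other-part r' w e Krw r'≢r)))
        #S∩≡ : #S∩ (rm2 Z v w) ≡ #S∩ Z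
        #S∩≡ = #S∩-rm2-outside Z v w sv (Y⇒¬S (K-Y {Y} {r} {w} Krw))

    outside-S : ∀ v → Z v ≡ true → S v ≡ false → PM Z
    outside-S v zv sv with rep-exists {Y} {v} (∧-intro (Z⊆X v zv) (cong not sv))
    ... | r , rep-r , Krv with oddb (# (KZ Z r)) in o
    ...   | true = Part.odd-part v r zv sv rep-r Krv o
    ...   | false = Part.even-part v r zv sv rep-r Krv o

    pm : PM Z
    pm with anyF (λ x → Z x ∧ not (S x)) in e
    ... | true = let (v , q) = anyF-elim _ e in outside-S v (proj₁ (∧-true {Z v} q)) (not≡true (proj₂ (∧-true {Z v} q)))
    ... | false = inside-S (anyF-false _ e)

  perfectMatching′ : ∀ k Z → # Z ≤ k → Good Z → PM Z
  perfectMatching′ k Z size good with # Z in e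
  ... | zero = PM-empty (#-zero Z e)
  perfectMatching′ (suc k) Z size (Z⊆X , even , inv) | suc m =
    Step.pm k (perfectMatching′ k) Z m e size Z⊆X even inv

  perfectMatching : (∀ x → S x ≡ true → X x ≡ true) → oddb (# X) ≡ false → oddc Y ≤ # S → PM X
  perfectMatching S⊆X even le = perfectMatching′ (# X) X ≤-refl ((λ _ e → e) , even , subst₂ _≤_ (sym parts≡) (sym #S∩≡) le)
    where
    parts≡ : oddParts X ≡ oddc Y
    parts≡ = #-cong (λ r → cong (λ t → rep Y r ∧ oddb t) (#-cong (KZ≡K r)))
      where
      KZ≡K : ∀ r x → KZ X r x ≡ K Y r x
      KZ≡K r x with K Y r x in k
      ... | false = refl
      ... | true = proj₁ (∧-true {X x} (K-Y {Y} {r} {x} k))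
    #S∩≡ : #S∩ X ≡ # S
    #S∩≡ = #-cong X∩S≡S
      where
      X∩S≡S : ∀ x → (X x ∧ S x) ≡ S x
      X∩S≡S x with S x in q
      ... | false = ∧-zeroʳ (X x)
      ... | true rewrite S⊆X x q = refl

module Partner {n : ℕ} (H' : Graph n) (X : Fin n → Bool) (M : Fin n → Fin n → Bool) (pm : Matchings.IsPM H' X M) where
  open Matchings H'

  partner : Fin n → Fin n
  partner x = fromMaybe x (find (M x))

  partner-M : ∀ {x} → X x ≡ true → M x (partner x) ≡ true
  partner-M {x} xx with proj₂ (proj₂ pm) x xx
  ... | w , m , _ with find (M x) | find-just (M x) w m
  ... | just j | .j , refl , q = q

  partner-unique : ∀ {x y} → M x y ≡ true → y ≡ partner x
  partner-unique {x} {y} m = PM-partner-unique {X} {M} pm m (partner-M (proj₁ (proj₂ (proj₁ (proj₂ pm) x y m))))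

  partner-∈ : ∀ {x} → X x ≡ true → X (partner x) ≡ true
  partner-∈ {x} xx = proj₂ (proj₂ (proj₁ (proj₂ pm) x (partner x) (partner-M xx)))

  partner-involutive : ∀ {x} → X x ≡ true → partner (partner x) ≡ x
  partner-involutive {x} xx = sym (partner-unique (trans (proj₁ pm (partner x) x) (partner-M xx)))

  partner-≢ : ∀ {x} → X x ≡ true → ¬ partner x ≡ x
  partner-≢ {x} xx eq = true≢false (subst (λ t → adj H' x t ≡ true) eq (proj₁ (proj₁ (proj₂ pm) x (partner x) (partner-M xx)))) (loopless H' x)

-- The walk
-- starts at d and alternately follows M1 (at even steps) and M2 (at odd steps); it first returns to d
-- along an alternating cycle through b. If that cycle avoids a and c, take M1 on it and M2 elsewhere
-- (NoHit). Otherwise cut it at its first vertex y ∈ {a, c}: M1 on the part before y, the edge yb,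
-- and M2 on the rest (FirstHit).
module AlternatingWalk {n : ℕ} (H : Graph n) (X : Fin n → Bool) (a b c d : Fin n)
  (hab : adj H a b ≡ true) (hbc : adj H b c ≡ true) (nac : adj H a c ≡ false) (ac : ¬ a ≡ c)
  (nbd : adj H b d ≡ false) (db : ¬ d ≡ b)
  (M1 M2 : Fin n → Fin n → Bool) (pm1 : Matchings.IsPM (addEdge H a c) X M1) (pm2 : Matchings.IsPM (addEdge H b d) X M2)
  (m1ac : M1 a c ≡ true) (m2bd : M2 b d ≡ true) where

  module Partner₁ = Partner (addEdge H a c) X M1 pm1
  module Partner₂ = Partner (addEdge H b d) X M2 pm2
  f1 : Fin n → Fin n
  f1 = Partner₁.partner
  f2 : Fin n → Fin n
  f2 = Partner₂.partner

  xd : X d ≡ true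
  xd = proj₂ (proj₂ (proj₁ (proj₂ pm2) b d m2bd))
  xb : X b ≡ true
  xb = proj₁ (proj₂ (proj₁ (proj₂ pm2) b d m2bd))

  partnerAt : ℕ → Fin n → Fin n
  partnerAt i x = if oddb i then f2 x else f1 x

  partnerAt-∈ : ∀ i {x} → X x ≡ true → X (partnerAt i x) ≡ true
  partnerAt-∈ i xx with oddb i
  ... | true = Partner₂.partner-∈ xx
  ... | false = Partner₁.partner-∈ xx

  partnerAt-involutive : ∀ i {x} → X x ≡ true → partnerAt i (partnerAt i x) ≡ x
  partnerAt-involutive i xx with oddb i
  ... | true = Partner₂.partner-involutive xx
  ... | false = Partner₁.partner-involutive xx

  partnerAt-≢ : ∀ i {x} → X x ≡ true → ¬ partnerAt i x ≡ x
  partnerAt-≢ i xx with oddb i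
  ... | true = Partner₂.partner-≢ xx
  ... | false = Partner₁.partner-≢ xx

  partnerAt-parity : ∀ i j → oddb i ≡ oddb j → ∀ x → partnerAt i x ≡ partnerAt j x
  partnerAt-parity i j e x rewrite e = refl

  walk : ℕ → Fin n
  walk zero = d
  walk (suc i) = partnerAt i (walk i)

  walk-∈ : ∀ i → X (walk i) ≡ true
  walk-∈ zero = xd
  walk-∈ (suc i) = partnerAt-∈ i (walk-∈ i)

  walk-back : ∀ i → partnerAt i (walk (suc i)) ≡ walk i
  walk-back i = partnerAt-involutive i (walk-∈ i)

  1+2* : ℕ → ℕ
  1+2* m = suc (m + m)

  par-flip : ∀ i m → oddb (suc (i + 1+2* m)) ≡ oddb i
  par-flip i m rewrite oddb-+ i (1+2* m) | oddb-2*+1 m with oddb i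
  ... | true = refl
  ... | false = refl

  no-odd-return : ∀ m i → walk i ≡ walk (i + 1+2* m) → ⊥
  no-odd-return zero i e = partnerAt-≢ i (walk-∈ i) (sym (trans e (cong walk (+-comm i 1))))
  no-odd-return (suc m) i e = no-odd-return m (suc i) e'
    where
    idx : i + 1+2* (suc m) ≡ suc (suc (i + 1+2* m))
    idx = trans (cong (λ t → i + suc (suc t)) (+-suc m m)) (trans (+-suc i (suc (1+2* m))) (cong suc (+-suc i (1+2* m))))
    e' : walk (suc i) ≡ walk (suc i + 1+2* m)
    e' = begin
      partnerAt i (walk i) ≡⟨ partnerAt-parity i (suc (i + 1+2* m)) (sym (par-flip i m)) (walk i) ⟩
      partnerAt (suc (i + 1+2* m)) (walk i) ≡⟨ cong (partnerAt (suc (i + 1+2* m))) (trans e (cong walk idx)) ⟩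
      partnerAt (suc (i + 1+2* m)) (walk (suc (suc (i + 1+2* m)))) ≡⟨ walk-back (suc (i + 1+2* m)) ⟩
      walk (suc (i + 1+2* m)) ∎
      where open ≡-Reasoning

  par-even : ∀ i m → oddb (i + (m + m)) ≡ oddb i
  par-even i m rewrite oddb-+ i (m + m) | oddb-2* m with oddb i
  ... | true = refl
  ... | false = refl

  even-return : ∀ i m → walk i ≡ walk (i + (m + m)) → walk 0 ≡ walk (m + m)
  even-return zero m e = e
  even-return (suc i) m e = even-return i m e'
    where
    e' : walk i ≡ walk (i + (m + m))
    e' = begin
      walk i ≡⟨ sym (walk-back i) ⟩
      partnerAt i (walk (suc i)) ≡⟨ cong (partnerAt i) e ⟩
      partnerAt i (walk (suc (i + (m + m)))) ≡⟨ partnerAt-parity i (i + (m + m)) (sym (par-even i m)) _ ⟩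
      partnerAt (i + (m + m)) (walk (suc (i + (m + m)))) ≡⟨ walk-back (i + (m + m)) ⟩
      walk (i + (m + m)) ∎
      where open ≡-Reasoning

  diff : ∀ {i j} → i < j → ∃ λ δ → 0 < δ × j ≡ i + δ
  diff {i} {j} lt = j ∸ i , m<n⇒0<n∸m lt , sym (m+[n∸m]≡n (<⇒≤ lt))

  repeat⇒return : ∀ i j → i < j → walk i ≡ walk j → ∃ λ q → suc q + suc q ≤ j × walk (suc q + suc q) ≡ d
  repeat⇒return i j lt e with diff lt
  ... | δ , pos , je with even-or-odd δ
  ... | m , inj₂ eo = ⊥-elim (no-odd-return m i (trans e (cong walk (trans je (cong (i +_) eo)))))
  ... | zero , inj₁ ee = ⊥-elim (<-irrefl (sym ee) pos)
  ... | suc q , inj₁ ee = q , subst (suc q + suc q ≤_) (sym (trans je (cong (i +_) ee))) (m≤n+m _ i) ,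
        sym (even-return i (suc q) (trans e (cong walk (trans je (cong (i +_) ee)))))

  returns : ∃ λ p → walk (suc p + suc p) ≡ d
  returns with FinP.pigeonhole (n<1+n n) (λ k → walk (toℕ k))
  ... | i , j , lt , e = let (q , _ , r) = repeat⇒return (toℕ i) (toℕ j) lt e in q , r

  returns? : ℕ → Bool
  returns? p = eqb (walk (suc p + suc p)) d

  open Matchings H using (PM; PM-union; PM-edge)

  module FirstReturn (p0 : ℕ) (walk-L : walk (suc p0 + suc p0) ≡ d) (minimal : ∀ q → q < p0 → walk (suc q + suc q) ≡ d → ⊥) where

    L : ℕ
    L = suc p0 + suc p0

    L-even : oddb L ≡ false
    L-even = oddb-2* (suc p0)

    distinct : ∀ i j → i < j → j < L → walk i ≡ walk j → ⊥
    distinct i j lt jL e with repeat⇒return i j lt e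
    ... | q , le , zq with <-cmp q p0
    ... | tri< l _ _ = minimal q l zq
    ... | tri≈ _ refl _ = <-irrefl refl (≤-<-trans le jL)
    ... | tri> _ _ p0<q = <-irrefl refl (≤-<-trans (+-mono-≤ (s≤s (<⇒≤ p0<q)) (s≤s (<⇒≤ p0<q))) (≤-<-trans le jL))

    partnerAt-even : ∀ i x → oddb i ≡ false → partnerAt i x ≡ f1 x
    partnerAt-even i x e rewrite e = refl

    partnerAt-odd : ∀ i x → oddb i ≡ true → partnerAt i x ≡ f2 x
    partnerAt-odd i x e rewrite e = refl

    f1-even : ∀ j → oddb j ≡ false → f1 (walk j) ≡ walk (suc j)
    f1-even j e = sym (partnerAt-even j (walk j) e)

    f2-odd : ∀ j → oddb j ≡ true → f2 (walk j) ≡ walk (suc j)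
    f2-odd j e = sym (partnerAt-odd j (walk j) e)

    f1-back : ∀ j → oddb j ≡ false → f1 (walk (suc j)) ≡ walk j
    f1-back j e = trans (sym (partnerAt-even j _ e)) (walk-back j)

    f2-back : ∀ j → oddb j ≡ true → f2 (walk (suc j)) ≡ walk j
    f2-back j e = trans (sym (partnerAt-odd j _ e)) (walk-back j)

    f2d : f2 d ≡ b
    f2d = sym (Partner₂.partner-unique (trans (proj₁ pm2 d b) m2bd))

    Lm1 : ℕ
    Lm1 = p0 + suc p0

    Lm1-odd : oddb Lm1 ≡ true
    Lm1-odd = trans (cong oddb (+-suc p0 p0)) (oddb-2*+1 p0)

    walk-Lm1 : walk Lm1 ≡ b
    walk-Lm1 = trans (sym (f2-back Lm1 Lm1-odd)) (trans (cong f2 walk-L) f2d)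

    onWalk : ℕ → Fin n → Bool
    onWalk k x = anyℕ k (λ j → eqb (walk j) x)

    onWalk-intro : ∀ {k j} → j < k → onWalk k (walk j) ≡ true
    onWalk-intro {k} {j} lt = anyℕ-intro k (λ i → eqb (walk i) (walk j)) j lt (eqb-refl (walk j))

    onWalk-elim : ∀ {k x} → onWalk k x ≡ true → ∃ λ j → j < k × walk j ≡ x
    onWalk-elim {k} {x} e = let (j , lt , q) = anyℕ-elim k (λ i → eqb (walk i) x) e in j , lt , eqb-true q

    onWalk-∈ : ∀ {k x} → onWalk k x ≡ true → X x ≡ true
    onWalk-∈ {k} {x} e = let (j , _ , q) = onWalk-elim {k} {x} e in subst (λ t → X t ≡ true) q (walk-∈ j)

    split-odd : ∀ j → oddb j ≡ true → ∃ λ j' → j ≡ suc j' × oddb j' ≡ false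
    split-odd (suc j) e = j , refl , trans (sym (not-involutive (oddb j))) (cong not e)

    split-even : ∀ j → oddb j ≡ false → j ≡ 0 ⊎ (∃ λ j' → j ≡ suc j' × oddb j' ≡ true)
    split-even zero e = inj₁ refl
    split-even (suc j) e = inj₂ (j , refl , notfalse' e)
      where
      notfalse' : ∀ {b} → not b ≡ false → b ≡ true
      notfalse' {true} _ = refl

    atAC : ℕ → Bool
    atAC i = eqb (walk i) a ∨ eqb (walk i) c

    M1-f : ∀ {x y} → M1 x y ≡ true → y ≡ f1 x
    M1-f = Partner₁.partner-unique
    M2-f : ∀ {x y} → M2 x y ≡ true → y ≡ f2 x
    M2-f = Partner₂.partner-unique

    module NoHit (none : ∀ i → i < L → atAC i ≡ false) where
      W : Fin n → Bool
      W = onWalk L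
      B : Fin n → Bool
      B x = X x ∧ not (W x)
      closed-M1 : ∀ x y → W x ≡ true → M1 x y ≡ true → W y ≡ true
      closed-M1 x y wx m with onWalk-elim {L} {x} wx
      ... | j , jL , refl rewrite M1-f m with oddb j in oj
      ... | false = subst (λ t → W t ≡ true) (sym (f1-even j oj)) (onWalk-intro (even-<-step j L oj L-even jL))
      ... | true with split-odd j oj
      ... | j' , refl , oj' = subst (λ t → W t ≡ true) (sym (f1-back j' oj')) (onWalk-intro (<-trans (n<1+n j') jL))
      closed-M2 : ∀ x y → W x ≡ true → M2 x y ≡ true → W y ≡ true
      closed-M2 x y wx m with onWalk-elim {L} {x} wx
      ... | j , jL , refl rewrite M2-f m with oddb j in oj
      ... | true with m≤n⇒m<n∨m≡n jL
      ... | inj₁ l = subst (λ t → W t ≡ true) (sym (f2-odd j oj)) (onWalk-intro l)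
      ... | inj₂ eq = subst (λ t → W t ≡ true) (sym (trans (f2-odd j oj) (trans (cong walk eq) walk-L))) (onWalk-intro {L} {0} (s≤s z≤n))
      closed-M2 x y wx m | j , jL , refl | false with split-even j oj
      ... | inj₁ refl = subst (λ t → W t ≡ true) (sym (trans f2d (sym walk-Lm1))) (onWalk-intro {L} {Lm1} (n<1+n Lm1))
      ... | inj₂ (j' , refl , oj') = subst (λ t → W t ≡ true) (sym (f2-back j' oj')) (onWalk-intro (<-trans (n<1+n j') jL))
      W-avoids-ac : ∀ x → W x ≡ true → ¬ x ≡ a × ¬ x ≡ c
      W-avoids-ac x wx with onWalk-elim {L} {x} wx
      ... | j , jL , refl = (λ e → true≢false (cong (_∨ eqb (walk j) c) (trans (cong (eqb (walk j)) (sym e)) (eqb-refl (walk j)))) (none j jL)) ,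
                            (λ e → true≢false (trans (cong (eqb (walk j) a ∨_) (trans (cong (eqb (walk j)) (sym e)) (eqb-refl (walk j)))) (∨-zeroʳ _)) (none j jL))
      edges-M1 : ∀ x y → W x ≡ true → M1 x y ≡ true → adj H x y ≡ true
      edges-M1 x y wx m with addEdge-elim H a c x y (proj₁ (proj₁ (proj₂ pm1) x y m))
      ... | inj₁ q = q
      ... | inj₂ (inj₁ (q , _)) = ⊥-elim (proj₁ (W-avoids-ac x wx) q)
      ... | inj₂ (inj₂ (q , _)) = ⊥-elim (proj₂ (W-avoids-ac x wx) q)
      wd : W d ≡ true
      wd = onWalk-intro {L} {0} (s≤s z≤n)
      wb : W b ≡ true
      wb = subst (λ t → W t ≡ true) walk-Lm1 (onWalk-intro {L} {Lm1} (n<1+n Lm1))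
      edges-M2 : ∀ x y → B x ≡ true → M2 x y ≡ true → adj H x y ≡ true
      edges-M2 x y bx m with addEdge-elim H b d x y (proj₁ (proj₁ (proj₂ pm2) x y m))
      ... | inj₁ q = q
      ... | inj₂ (inj₁ (refl , _)) = ⊥-elim (true≢false (proj₂ (∧-true {X x} bx)) (cong not wb))
      ... | inj₂ (inj₂ (refl , _)) = ⊥-elim (true≢false (proj₂ (∧-true {X x} bx)) (cong not wd))
      pmA : PM W
      pmA = PM-restrict-closed H (addEdge H a c) pm1 (λ x e → onWalk-∈ {L} {x} e) closed-M1 edges-M1
      pmB : PM B
      pmB = PM-restrict-closed H (addEdge H b d) pm2 (λ x e → proj₁ (∧-true {X x} e)) (complement-closed (addEdge H b d) pm2 closed-M2) edges-M2
      X-split : ∀ x → X x ≡ (W x ∨ B x)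
      X-split x with W x in wx
      ... | true = onWalk-∈ {L} {x} wx
      ... | false = sym (∧-identityʳ (X x))
      disjoint : ∀ x → W x ≡ true → B x ≡ true → ⊥
      disjoint x wx bx = true≢false (proj₂ (∧-true {X x} bx)) (cong not wx)

      pm : PM X
      pm = PM-union {X} {W} {B} X-split disjoint pmA pmB

    ∨-split : ∀ xv zv → (zv ≡ true → xv ≡ true) → xv ≡ (zv ∨ (xv ∧ not zv))
    ∨-split true true f = refl
    ∨-split true false f = refl
    ∨-split false true f = f refl
    ∨-split false false f = refl

    ∨-split₂ : ∀ xv zv yb → (yb ≡ true → xv ≡ true) → (yb ≡ true → zv ≡ false) → (xv ∧ not zv) ≡ (yb ∨ (xv ∧ not (zv ∨ yb)))
    ∨-split₂ true true true f g = ⊥-elim (true≢false refl (g refl))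
    ∨-split₂ true true false f g = refl
    ∨-split₂ true false true f g = refl
    ∨-split₂ true false false f g = refl
    ∨-split₂ false zv true f g = f refl
    ∨-split₂ false true false f g = refl
    ∨-split₂ false false false f g = refl

    ba : ¬ b ≡ a
    ba eq = true≢false (subst (λ t → adj H a t ≡ true) eq hab) (loopless H a)
    bc : ¬ b ≡ c
    bc eq = true≢false (subst (λ t → adj H t c ≡ true) eq hbc) (loopless H c)
    da : ¬ d ≡ a
    da eq = true≢false (trans (gsym H b a) hab) (subst (λ t → adj H b t ≡ false) eq nbd)
    dc : ¬ d ≡ c
    dc eq = true≢false hbc (subst (λ t → adj H b t ≡ false) eq nbd)

    atAC-elim : ∀ j → atAC j ≡ true → walk j ≡ a ⊎ walk j ≡ c
    atAC-elim j e with ∨-true {eqb (walk j) a} e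
    ... | inj₁ q = inj₁ (eqb-true q)
    ... | inj₂ q = inj₂ (eqb-true q)

    atAC-intro : ∀ j → walk j ≡ a ⊎ walk j ≡ c → atAC j ≡ true
    atAC-intro j (inj₁ e) = cong (_∨ eqb (walk j) c) (trans (cong (eqb (walk j)) (sym e)) (eqb-refl (walk j)))
    atAC-intro j (inj₂ e) = trans (cong (eqb (walk j) a ∨_) (trans (cong (eqb (walk j)) (sym e)) (eqb-refl (walk j)))) (∨-zeroʳ _)

    f1a : f1 a ≡ c
    f1a = sym (M1-f m1ac)
    f1c : f1 c ≡ a
    f1c = sym (M1-f (trans (proj₁ pm1 c a) m1ac))
    f2b : f2 b ≡ d
    f2b = sym (M2-f m2bd)

    module FirstHit (i : ℕ) (iL : i < L) (qi : atAC i ≡ true) (minI : ∀ j → j < i → atAC j ≡ false) where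
      i≠0 : ¬ i ≡ 0
      i≠0 refl with atAC-elim 0 qi
      ... | inj₁ e = da e
      ... | inj₂ e = dc e
      oi : oddb i ≡ false
      oi with oddb i in o
      ... | false = refl
      ... | true with split-odd i o
      ... | i' , refl , oi' = ⊥-elim (true≢false (atAC-intro i' h) (minI i' (n<1+n i')))
        where
        h : walk i' ≡ a ⊎ walk i' ≡ c
        h with atAC-elim (suc i') qi
        ... | inj₁ e = inj₂ (trans (sym (f1-back i' oi')) (trans (cong f1 e) f1a))
        ... | inj₂ e = inj₁ (trans (sym (f1-back i' oi')) (trans (cong f1 e) f1c))
      iLm1 : i < Lm1
      iLm1 with m≤n⇒m<n∨m≡n (≤-pred iL)
      ... | inj₁ l = l
      ... | inj₂ refl = ⊥-elim (true≢false Lm1-odd oi)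
      y : Fin n
      y = walk i
      Z : Fin n → Bool
      Z = onWalk i
      YB : Fin n → Bool
      YB x = eqb x y ∨ eqb x b
      Z' : Fin n → Bool
      Z' x = Z x ∨ YB x
      C : Fin n → Bool
      C x = X x ∧ not (Z' x)
      R : Fin n → Bool
      R x = X x ∧ not (Z x)
      yZ : Z y ≡ false
      yZ with Z y in q
      ... | false = refl
      ... | true = let (j , ji , e) = onWalk-elim {i} {y} q in ⊥-elim (distinct j i ji iL e)
      bZ : Z b ≡ false
      bZ with Z b in q
      ... | false = refl
      ... | true = let (j , ji , e) = onWalk-elim {i} {b} q in ⊥-elim (distinct j Lm1 (<-trans ji iLm1) (n<1+n Lm1) (trans e (sym walk-Lm1)))
      yb : ¬ y ≡ b
      yb e with atAC-elim i qi
      ... | inj₁ q = ba (trans (sym e) q)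
      ... | inj₂ q = bc (trans (sym e) q)
      ayb : adj H y b ≡ true
      ayb with atAC-elim i qi
      ... | inj₁ q = subst (λ t → adj H t b ≡ true) (sym q) hab
      ... | inj₂ q = subst (λ t → adj H t b ≡ true) (sym q) (trans (gsym H c b) hbc)
      acZ : ∀ x → Z x ≡ true → ¬ x ≡ a × ¬ x ≡ c
      acZ x zx with onWalk-elim {i} {x} zx
      ... | j , ji , refl = (λ e → true≢false (atAC-intro j (inj₁ e)) (minI j ji)) , (λ e → true≢false (atAC-intro j (inj₂ e)) (minI j ji))
      closed-M1 : ∀ x w → Z x ≡ true → M1 x w ≡ true → Z w ≡ true
      closed-M1 x w zx m with onWalk-elim {i} {x} zx
      ... | j , ji , refl rewrite M1-f m with oddb j in oj
      ... | false = subst (λ t → Z t ≡ true) (sym (f1-even j oj)) (onWalk-intro (even-<-step j i oj oi ji))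
      ... | true with split-odd j oj
      ... | j' , refl , oj' = subst (λ t → Z t ≡ true) (sym (f1-back j' oj')) (onWalk-intro (<-trans (n<1+n j') ji))
      YB-y : Z' y ≡ true
      YB-y = trans (cong (λ t → Z y ∨ (t ∨ eqb y b)) (eqb-refl y)) (∨-zeroʳ (Z y))
      YB-b : Z' b ≡ true
      YB-b = trans (cong (λ t → Z b ∨ (eqb b y ∨ t)) (eqb-refl b)) (trans (cong (Z b ∨_) (∨-zeroʳ (eqb b y))) (∨-zeroʳ (Z b)))
      Z⊆Z' : ∀ x → Z x ≡ true → Z' x ≡ true
      Z⊆Z' x e = cong (_∨ YB x) e
      closed-M2 : ∀ x w → Z' x ≡ true → M2 x w ≡ true → Z' w ≡ true
      closed-M2 x w zx m with ∨-true {Z x} zx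
      closed-M2 x w zx m | inj₁ zx1 with onWalk-elim {i} {x} zx1
      ... | j , ji , refl rewrite M2-f m with oddb j in oj
      ... | true with m≤n⇒m<n∨m≡n ji
      ... | inj₁ l = subst (λ t → Z' t ≡ true) (sym (f2-odd j oj)) (Z⊆Z' _ (onWalk-intro l))
      ... | inj₂ eq = subst (λ t → Z' t ≡ true) (sym (trans (f2-odd j oj) (cong walk eq))) YB-y
      closed-M2 x w zx m | inj₁ zx1 | j , ji , refl | false with split-even j oj
      ... | inj₁ refl = subst (λ t → Z' t ≡ true) (sym f2d) YB-b
      ... | inj₂ (j' , refl , oj') = subst (λ t → Z' t ≡ true) (sym (f2-back j' oj')) (Z⊆Z' _ (onWalk-intro (<-trans (n<1+n j') ji)))
      closed-M2 x w zx m | inj₂ ybx with ∨-true {eqb x y} ybx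
      ... | inj₁ ey rewrite eqb-true ey | M2-f m with split-even i oi
      ... | inj₁ e0 = ⊥-elim (i≠0 e0)
      ... | inj₂ (i' , refl , oi') = subst (λ t → Z' t ≡ true) (sym (f2-back i' oi')) (Z⊆Z' _ (onWalk-intro (n<1+n i')))
      closed-M2 x w zx m | inj₂ ybx | inj₂ eb rewrite eqb-true eb | M2-f m = subst (λ t → Z' t ≡ true) (sym f2b)
          (Z⊆Z' _ (onWalk-intro {i} {0} (n≢0⇒n>0 i≠0)))
      edges-M1 : ∀ x w → Z x ≡ true → M1 x w ≡ true → adj H x w ≡ true
      edges-M1 x w zx m with addEdge-elim H a c x w (proj₁ (proj₁ (proj₂ pm1) x w m))
      ... | inj₁ q = q
      ... | inj₂ (inj₁ (q , _)) = ⊥-elim (proj₁ (acZ x zx) q)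
      ... | inj₂ (inj₂ (q , _)) = ⊥-elim (proj₂ (acZ x zx) q)
      edges-M2 : ∀ x w → C x ≡ true → M2 x w ≡ true → adj H x w ≡ true
      edges-M2 x w cx m with addEdge-elim H b d x w (proj₁ (proj₁ (proj₂ pm2) x w m))
      ... | inj₁ q = q
      ... | inj₂ (inj₁ (refl , _)) = ⊥-elim (true≢false (proj₂ (∧-true {X x} cx)) (cong not YB-b))
      ... | inj₂ (inj₂ (refl , _)) = ⊥-elim (true≢false (proj₂ (∧-true {X x} cx)) (cong not (Z⊆Z' d (onWalk-intro {i} {0} (n≢0⇒n>0 i≠0)))))
      pmZ : PM Z
      pmZ = PM-restrict-closed H (addEdge H a c) pm1 (λ x e → onWalk-∈ {i} {x} e) closed-M1 edges-M1
      pmYB : PM YB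
      pmYB = PM-edge y b yb ayb
      pmC : PM C
      pmC = PM-restrict-closed H (addEdge H b d) pm2 (λ x e → proj₁ (∧-true {X x} e)) (complement-closed (addEdge H b d) pm2 closed-M2) edges-M2
      YB-X : ∀ x → YB x ≡ true → X x ≡ true
      YB-X x e with ∨-true {eqb x y} e
      ... | inj₁ q = subst (λ t → X t ≡ true) (sym (eqb-true q)) (walk-∈ i)
      ... | inj₂ q = subst (λ t → X t ≡ true) (sym (eqb-true q)) xb
      YB-Z : ∀ x → YB x ≡ true → Z x ≡ false
      YB-Z x e with ∨-true {eqb x y} e
      ... | inj₁ q = subst (λ t → Z t ≡ false) (sym (eqb-true q)) yZ
      ... | inj₂ q = subst (λ t → Z t ≡ false) (sym (eqb-true q)) bZ
      pmR : PM R
      pmR = PM-union {R} {YB} {C} (λ x → ∨-split₂ (X x) (Z x) (YB x) (YB-X x) (YB-Z x)) disjoint′ pmYB pmC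
        where
        disjoint′ : ∀ x → YB x ≡ true → C x ≡ true → ⊥
        disjoint′ x yx cx = true≢false (proj₂ (∧-true {X x} cx)) (cong not (trans (cong (Z x ∨_) yx) (∨-zeroʳ (Z x))))
      X-split : ∀ x → X x ≡ (Z x ∨ R x)
      X-split x = ∨-split (X x) (Z x) (onWalk-∈ {i} {x})
      disjoint : ∀ x → Z x ≡ true → R x ≡ true → ⊥
      disjoint x zx rx = true≢false (proj₂ (∧-true {X x} rx)) (cong not zx)

      pm : PM X
      pm = PM-union {X} {Z} {R} X-split disjoint pmZ pmR

    least≤ : ∀ {i i0} → atAC i0 ≡ true → (∀ j → j < i → atAC j ≡ false) → i ≤ i0
    least≤ {i} {i0} qi0 minI with i ≤? i0
    ... | yes i≤i0 = i≤i0
    ... | no i≰i0 = ⊥-elim (true≢false qi0 (minI i0 (≰⇒> i≰i0)))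

    pm : PM X
    pm with anyℕ L atAC in e
    ... | true = let (i0 , i0L , qi0) = anyℕ-elim L atAC e
                     (i , qi , minI) = least-ℕ atAC i0 qi0
                 in FirstHit.pm i (≤-<-trans (least≤ qi0 minI) i0L) qi minI
    ... | false = NoHit.pm (anyℕ-false L atAC e)

  pm : PM X
  pm with least-ℕ returns? (proj₁ returns) (subst (λ t → eqb t d ≡ true) (sym (proj₂ returns)) (eqb-refl d))
  ... | p0 , zp , mn = FirstReturn.pm p0 (eqb-true zp) (λ q lt e → true≢false (subst (λ t → eqb t d ≡ true) (sym e) (eqb-refl d)) (mn q lt))

PM-drop : ∀ {n} (H : Graph n) X a c M → Matchings.IsPM (addEdge H a c) X M → M a c ≡ false → Matchings.PM H X
PM-drop H X a c M (s , e , p) mac = M , s , e' , p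
  where
  e' : ∀ u v → M u v ≡ true → adj H u v ≡ true × X u ≡ true × X v ≡ true
  e' u v m with e u v m
  ... | ad , xu , xv with addEdge-elim H a c u v ad
  ... | inj₁ q = q , xu , xv
  ... | inj₂ (inj₁ (refl , refl)) = ⊥-elim (true≢false m mac)
  ... | inj₂ (inj₂ (refl , refl)) = ⊥-elim (true≢false (trans (s a c) m) mac)

PM-from-added-edges : ∀ {n} (H : Graph n) (X : Fin n → Bool) (a b c d : Fin n) →
  adj H a b ≡ true → adj H b c ≡ true → adj H a c ≡ false → ¬ a ≡ c → adj H b d ≡ false → ¬ d ≡ b →
  Matchings.PM (addEdge H a c) X → Matchings.PM (addEdge H b d) X → Matchings.PM H X
PM-from-added-edges H X a b c d hab hbc nac ac nbd db (M1 , pm1) (M2 , pm2) with M1 a c in e1 | M2 b d in e2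
... | false | _ = PM-drop H X a c M1 pm1 e1
... | true | false = PM-drop H X b d M2 pm2 e2
... | true | true = AlternatingWalk.pm H X a b c d hab hbc nac ac nbd db M1 M2 pm1 pm2 e1 e2

induced-path : ∀ {n} (H : Graph n) {Y u w} → Walks.W H Y u w → ∀ v → (u ≡ v ⊎ adj H v u ≡ true) → adj H v w ≡ false → ¬ v ≡ w →
  ∃ λ b → ∃ λ c → Y b ≡ true × Y c ≡ true × adj H v b ≡ true × adj H b c ≡ true × adj H v c ≡ false × ¬ v ≡ c
induced-path H (Walks.here p) v (inj₁ refl) v≁w v≢w = ⊥-elim (v≢w refl)
induced-path H (Walks.here p) v (inj₂ v~u) v≁w v≢w = ⊥-elim (true≢false v~u v≁w)
induced-path H {Y} {u} (Walks.step {w = x} yu u~x rest) v start v≁w v≢w with x ≟ v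
... | yes refl = induced-path H rest v (inj₁ refl) v≁w v≢w
... | no x≢v with adj H v x in v~x
... | true = induced-path H rest v (inj₂ v~x) v≁w v≢w
... | false with start
... | inj₁ refl = ⊥-elim (true≢false u~x v~x)
... | inj₂ v~u = u , x , yu , Walks.W-start H rest , v~u , u~x , v~x , (λ v≡x → x≢v (sym v≡x))

module Tutte {n : ℕ} (X : Fin n → Bool) where
  open Matchings using (PM)

  Y[_] : (Fin n → Bool) → Fin n → Bool
  Y[ S ] x = X x ∧ not (S x)

  TutteViolation : Graph n → (Fin n → Bool) → Set
  TutteViolation H S = (∀ x → S x ≡ true → X x ≡ true) × suc (# S) ≤ Components.oddc H Y[ S ]

  NonEdge : Graph n → Fin n → Fin n → Set
  NonEdge H a c = X a ≡ true × X c ≡ true × ¬ a ≡ c × adj H a c ≡ false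

  NonEdge? : ∀ H a c → Dec (NonEdge H a c)
  NonEdge? H a c = ≡true? (X a) ×-dec (≡true? (X c) ×-dec (¬? (a ≟ c) ×-dec ≡false? (adj H a c)))
    where
    ≡true? : ∀ b → Dec (b ≡ true)
    ≡true? b = b ≟b true
    ≡false? : ∀ b → Dec (b ≡ false)
    ≡false? b = b ≟b false

  odd-violation : ∀ H → oddb (# X) ≡ true → Σ (Fin n → Bool) (TutteViolation H)
  odd-violation H odd = (λ _ → false) , (λ x ()) , subst (λ t → suc t ≤ oddc Y[ ∅ ]) (sym (∑-0 {n} (λ _ → refl)))
      (odd⇒pos (trans (sym (parity Y[ ∅ ])) (trans (cong oddb (#-cong (λ x → ∧-identityʳ (X x)))) odd)))
    where
    open Components H
    ∅ : Fin n → Bool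
    ∅ _ = false

  violation-add : ∀ H a c → Σ (Fin n → Bool) (TutteViolation (addEdge H a c)) → Σ (Fin n → Bool) (TutteViolation H)
  violation-add H a c (S , S⊆X , violation) = S , S⊆X , ≤-trans violation (oddc-mono H (addEdge H a c) (addEdge-⊇ H a c) Y[ S ])

  module Saturated (H : Graph n) (even : oddb (# X) ≡ false) (¬pm : ¬ PM H X)
                   (unsat : ¬ (∃ λ a → ∃ λ c → NonEdge H a c × ¬ PM (addEdge H a c) X)) where
    open Components H

    saturated : ∀ a c → NonEdge H a c → PM (addEdge H a c) X
    saturated a c ne with Matchings.PM-dec (addEdge H a c) X
    ... | yes pm = pm
    ... | no ¬pm' = ⊥-elim (unsat (a , c , ne , ¬pm'))

    S : Fin n → Bool
    S v = X v ∧ allF (λ w → not (X w) ∨ (eqb w v ∨ adj H v w))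

    S⊆X : ∀ x → S x ≡ true → X x ≡ true
    S⊆X x e = proj₁ (∧-true {X x} e)

    S-adjacent : ∀ s x → S s ≡ true → X x ≡ true → ¬ x ≡ s → adj H s x ≡ true
    S-adjacent s x ss xx x≢s = decode (allF-elim _ (proj₂ (∧-true {X s} ss)) x) xx (eqb-false x≢s)
      where
      decode : ∀ {p q r} → not p ∨ (q ∨ r) ≡ true → p ≡ true → q ≡ false → r ≡ true
      decode {true} {false} {true} _ _ _ = refl

    ¬S⇒non-neighbour : ∀ b → X b ≡ true → S b ≡ false → ∃ λ d → X d ≡ true × ¬ d ≡ b × adj H b d ≡ false
    ¬S⇒non-neighbour b xb sb with allF (λ w → not (X w) ∨ (eqb w b ∨ adj H b w)) in e
    ... | true = ⊥-elim (true≢false (trans (∧-identityʳ (X b)) xb) sb)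
    ... | false with allF-false _ e
    ...   | d , e′ = let (xd , d≢b , b≁d) = decode {X d} {eqb d b} {adj H b d} e′ in
                     d , xd , (λ d≡b → true≢false (trans (cong (eqb d) (sym d≡b)) (eqb-refl d)) d≢b) , b≁d
      where
      decode : ∀ {p q r} → not p ∨ (q ∨ r) ≡ false → p ≡ true × q ≡ false × r ≡ false
      decode {true} {false} {false} _ = refl , refl , refl

    Y : Fin n → Bool
    Y = Y[ S ]

    complete? : Bool
    complete? = allF (λ v → allF (λ w → not (K Y v w ∧ not (eqb v w)) ∨ adj H v w))

    complete : complete? ≡ true → ∀ v w → K Y v w ≡ true → ¬ v ≡ w → adj H v w ≡ true
    complete e v w Kvw v≢w = decode (allF-elim _ (allF-elim _ e v) w) Kvw (eqb-false v≢w)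
      where
      decode : ∀ {p q r} → not (p ∧ not q) ∨ r ≡ true → p ≡ true → q ≡ false → r ≡ true
      decode {true} {false} {true} _ _ _ = refl

    incomplete : complete? ≡ false → ∃ λ v → ∃ λ w → K Y v w ≡ true × ¬ v ≡ w × adj H v w ≡ false
    incomplete e with allF-false _ e
    ... | v , e₁ with allF-false _ e₁
    ... | w , e₂ = let (Kvw , v≢w , v≁w) = decode {K Y v w} {eqb v w} {adj H v w} e₂ in
                   v , w , Kvw , (λ v≡w → true≢false (trans (cong (eqb v) (sym v≡w)) (eqb-refl v)) v≢w) , v≁w
      where
      decode : ∀ {p q r} → not (p ∧ not q) ∨ r ≡ false → p ≡ true × q ≡ false × r ≡ false
      decode {true} {false} {false} _ = refl , refl , refl

    incomplete-PM : complete? ≡ false → PM H X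
    incomplete-PM e with incomplete e
    ... | v , w , Kvw , v≢w , v≁w with induced-path H (K-walk {Y} {v} {w} Kvw) v (inj₁ refl) v≁w v≢w
    ... | b , c , yb , yc , v~b , b~c , v≁c , v≢c with ¬S⇒non-neighbour b (proj₁ (∧-true {X b} yb)) (not≡true (proj₂ (∧-true {X b} yb)))
    ... | d , xd , d≢b , b≁d = PM-from-added-edges H X v b c d v~b b~c v≁c v≢c b≁d d≢b
          (saturated v c (proj₁ (∧-true {X v} (K-Yv {Y} {v} {w} Kvw)) , proj₁ (∧-true {X c} yc) , v≢c , v≁c))
          (saturated b d (proj₁ (∧-true {X b} yb) , xd , (λ b≡d → d≢b (sym b≡d)) , b≁d))

    violation : Σ (Fin n → Bool) (TutteViolation H)
    violation with suc (# S) ≤? oddc Y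
    ... | yes lt = S , S⊆X , lt
    ... | no nlt = ⊥-elim (¬pm (pm (≤-pred (≰⇒> nlt))))
      where
      pm : oddc Y ≤ # S → PM H X
      pm le with complete? in e
      ... | true = CompleteComponents.perfectMatching H X S S-adjacent (complete e) S⊆X even le
      ... | false = incomplete-PM e

  tutte′ : ∀ k (H : Graph n) → nonEdges H X ≤ k → ¬ PM H X → Σ (Fin n → Bool) (TutteViolation H)
  tutte′ k H bound ¬pm with oddb (# X) in parity-X
  ... | true = odd-violation H parity-X
  ... | false with FinP.any? (λ a → FinP.any? (λ c → NonEdge? H a c ×-dec ¬? (Matchings.PM-dec (addEdge H a c) X)))
  ...   | no unsat = Saturated.violation H parity-X ¬pm unsat
  tutte′ zero H bound ¬pm | false | yes (a , c , (xa , xc , a≢c , a≁c) , _) =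
    ⊥-elim (n≮0 (≤-trans (nonEdges-add H X a c xa xc a≢c a≁c) bound))
  tutte′ (suc k) H bound ¬pm | false | yes (a , c , (xa , xc , a≢c , a≁c) , ¬pm') =
    violation-add H a c (tutte′ k (addEdge H a c) (≤-pred (≤-trans (nonEdges-add H X a c xa xc a≢c a≁c) bound)) ¬pm')

  tutte : ∀ (H : Graph n) → ¬ PM H X → Σ (Fin n → Bool) (TutteViolation H)
  tutte H = tutte′ (nonEdges H X) H ≤-refl

-- Odd components in 2-connected cubic graphs

cubic-even-order : ∀ {n} (G : Graph n) → (∀ x → # (adj G x) ≡ 3) → oddb n ≡ false
cubic-even-order {n} G deg =
  trans (sym (oddb-3* n)) (trans (cong oddb handshake) (∑∑-symmetric-even (λ x y → bit (adj G x y)) (λ x y → cong bit (gsym G x y)) (λ x → cong bit (loopless G x))))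
  where
  handshake : 3 * n ≡ ∑ (λ x → ∑ (λ y → bit (adj G x y)))
  handshake = trans (*-comm 3 n) (trans (sym (∑-const {n} 3)) (∑-cong (λ x → sym (deg x))))

-- An odd component C of G − S sends 3|C| − 2e(C) edges to S, an odd number, and at least two
-- because G is 2-connected; counting these edges at S gives 3 · o(G − S) ≤ 3|S|.
module CubicBound {n : ℕ} (G : Graph n) (deg : ∀ x → # (adj G x) ≡ 3)
  (avoiding : ∀ s x y → ¬ x ≡ s → ¬ y ≡ s → Walks.W G (λ z → not (eqb z s)) x y) (S : Fin n → Bool) where
  open Walks G
  open Components G

  Y : Fin n → Bool
  Y x = not (S x)

  C : Fin n → Fin n → Bool
  C r = K Y r

  crossing : Fin n → Fin n → Fin n → ℕ
  crossing r x s = bit (C r x ∧ (S s ∧ adj G x s))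

  crossings : Fin n → ℕ
  crossings r = ∑ (λ x → ∑ (λ s → crossing r x s))

  C⇒¬S : ∀ r x → C r x ≡ true → S x ≡ false
  C⇒¬S r x k with S x in q
  ... | false = refl
  ... | true = ⊥-elim (true≢false (K-Y {Y} {r} {x} k) (cong not q))

  crossings-odd : ∀ r → oddb (# (C r)) ≡ true → oddb (crossings r) ≡ true
  crossings-odd r o = trans (sym (trans (cong oddb 3|C|≡) (trans (oddb-+ internal (crossings r)) (cong (_xor oddb (crossings r)) internal-even)))) (trans (oddb-3* (# (C r))) o)
    where
    internal : ℕ
    internal = ∑ (λ x → ∑ (λ y → bit ((C r x ∧ adj G x y) ∧ C r y)))
    internal-even : oddb internal ≡ false
    internal-even = ∑∑-symmetric-even (λ x y → bit ((C r x ∧ adj G x y) ∧ C r y)) symmetric diagonal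
      where
      symmetric : ∀ x y → bit ((C r x ∧ adj G x y) ∧ C r y) ≡ bit ((C r y ∧ adj G y x) ∧ C r x)
      symmetric x y rewrite gsym G x y with C r x | C r y | adj G y x
      ... | true | true | t = refl
      ... | true | false | t = cong bit (∧-zeroʳ t)
      ... | false | true | t = sym (cong bit (∧-zeroʳ t))
      ... | false | false | t = refl
      diagonal : ∀ x → bit ((C r x ∧ adj G x x) ∧ C r x) ≡ 0
      diagonal x rewrite loopless G x = cong (λ t → bit (t ∧ C r x)) (∧-zeroʳ (C r x))
    split : ∀ x y → bit (C r x ∧ adj G x y) ≡ bit ((C r x ∧ adj G x y) ∧ C r y) + crossing r x y
    split x y = trans (bit-split (C r x ∧ adj G x y) (C r y)) (cong (bit ((C r x ∧ adj G x y) ∧ C r y) +_) (cong bit (boundary (C r x) (adj G x y) refl refl)))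
      where
      boundary : ∀ cx a → C r x ≡ cx → adj G x y ≡ a → ((cx ∧ a) ∧ not (C r y)) ≡ (cx ∧ (S y ∧ a))
      boundary false a _ _ = refl
      boundary true false _ _ = sym (∧-zeroʳ (S y))
      boundary true true kx ax with C r y in ky | S y in sy
      ... | true | true = ⊥-elim (true≢false sy (C⇒¬S r y ky))
      ... | true | false = refl
      ... | false | true = refl
      ... | false | false = ⊥-elim (true≢false (K-closed {Y} {r} {x} {y} kx (cong not sy) ax) ky)
    row : ∀ x → bit (C r x) * 3 ≡ ∑ (λ y → bit (C r x ∧ adj G x y))
    row x with C r x
    ... | true = sym (deg x)
    ... | false = sym (∑-0 {n} {f = λ y → 0} (λ y → refl))
    3|C|≡ : 3 * # (C r) ≡ internal + crossings r
    3|C|≡ = begin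
      3 * # (C r) ≡⟨ sym (∑-*ˡ 3 (λ x → bit (C r x))) ⟩
      ∑ (λ x → 3 * bit (C r x)) ≡⟨ ∑-cong (λ x → trans (*-comm 3 (bit (C r x))) (row x)) ⟩
      ∑ (λ x → ∑ (λ y → bit (C r x ∧ adj G x y))) ≡⟨ ∑-cong (λ x → trans (∑-cong (split x)) (∑-+ (λ y → bit ((C r x ∧ adj G x y) ∧ C r y)) (λ y → crossing r x y))) ⟩
      ∑ (λ x → ∑ (λ y → bit ((C r x ∧ adj G x y) ∧ C r y)) + ∑ (λ y → crossing r x y)) ≡⟨ ∑-+ (λ x → ∑ (λ y → bit ((C r x ∧ adj G x y) ∧ C r y))) (λ x → ∑ (λ y → crossing r x y)) ⟩
      internal + crossings r ∎
      where open ≡-Reasoning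

  bit-pos : ∀ {b} → 0 < bit b → b ≡ true
  bit-pos {true} _ = refl

  odd-≥2⇒≥3 : ∀ {m} → oddb m ≡ true → 2 ≤ m → 3 ≤ m
  odd-≥2⇒≥3 {suc (suc zero)} () _
  odd-≥2⇒≥3 {suc zero} _ (s≤s ())
  odd-≥2⇒≥3 {suc (suc (suc m))} _ _ = s≤s (s≤s (s≤s z≤n))

  crossing-pos : ∀ {r x s} → C r x ≡ true → S s ≡ true → adj G x s ≡ true → 1 ≤ crossing r x s
  crossing-pos cx ss a rewrite cx | ss | a = ≤-refl

  two-crossings-via : ∀ r x0 s0 y → C r x0 ≡ true → S s0 ≡ true → adj G x0 s0 ≡ true → adj G s0 y ≡ true → ¬ y ≡ x0 → 2 ≤ crossings r
  two-crossings-via r x0 s0 y cx0 ss0 a0 asy yx0 = by-y (C r y) refl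
    where
    x0s0-crossing : 1 ≤ crossing r x0 s0
    x0s0-crossing = crossing-pos {r} {x0} {s0} cx0 ss0 a0
    x0≢s0 : ¬ x0 ≡ s0
    x0≢s0 q = true≢false ss0 (trans (cong S (sym q)) (C⇒¬S r x0 cx0))
    y≢s0 : ¬ y ≡ s0
    y≢s0 q = true≢false (subst (λ t → adj G s0 t ≡ true) q asy) (loopless G s0)
    cross : ∀ {p q} → C r p ≡ true → C r q ≡ false → not (eqb q s0) ≡ true → adj G p q ≡ true → 2 ≤ crossings r
    cross {p} {q} cp cq ysq apq = ∑∑-two (crossing r) x0 s0 p q x0s0-crossing (crossing-pos {r} {p} {q} cp S-q apq) (inj₂ s0≢q)
      where
      s0≢q : ¬ s0 ≡ q
      s0≢q e = true≢false ysq (cong not (trans (cong (eqb q) e) (eqb-refl q)))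
      S-q : S q ≡ true
      S-q with S q in e
      ... | true = refl
      ... | false = ⊥-elim (true≢false (K-closed {Y} {r} {p} {q} cp (cong not e) apq) cq)
    by-y : ∀ t → C r y ≡ t → 2 ≤ crossings r
    by-y true cy = ∑∑-two (crossing r) x0 s0 y s0 x0s0-crossing (crossing-pos {r} {y} {s0} cy ss0 (trans (gsym G y s0) asy)) (inj₁ (λ q → yx0 (sym q)))
    by-y false cy with W-cross (C r) (avoiding s0 x0 y x0≢s0 y≢s0) cx0 cy
    ... | p , q , cp , cq , _ , ysq , apq = cross cp cq ysq apq

  two-crossings : ∀ r x0 s0 → C r x0 ≡ true → S s0 ≡ true → adj G x0 s0 ≡ true → 2 ≤ crossings r
  two-crossings r x0 s0 cx0 ss0 a0 with #-pos (rm (adj G s0) x0) (subst (0 <_) (sym #others) (s≤s z≤n))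
    where
    #others : # (rm (adj G s0) x0) ≡ 2
    #others = suc-injective (trans (sym (#-rm (adj G s0) x0 (trans (gsym G s0 x0) a0))) (deg s0))
  ... | y , my = two-crossings-via r x0 s0 y cx0 ss0 a0 (rm-⊆ {X = adj G s0} {x0} {y} my) (rm-≢ {X = adj G s0} {x0} {y} my)

  three-crossings : ∀ r → oddb (# (C r)) ≡ true → 3 ≤ crossings r
  three-crossings r o with ∑-pos {f = λ x → ∑ (λ s → crossing r x s)} (odd⇒pos (crossings-odd r o))
  ... | x0 , p with ∑-pos {f = λ s → crossing r x0 s} p
  ... | s0 , p' with bit-pos {C r x0 ∧ (S s0 ∧ adj G x0 s0)} p'
  ... | t0 = odd-≥2⇒≥3 (crossings-odd r o) (two-crossings r x0 s0 (proj₁ (∧-true {C r x0} t0)) (proj₁ (∧-true {S s0} (proj₂ (∧-true {C r x0} t0))))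
                 (proj₂ (∧-true {S s0} (proj₂ (∧-true {C r x0} t0)))))

  toS : Fin n → Fin n → Bool
  toS x s = S s ∧ adj G x s

  incident : Fin n → Fin n → Fin n → ℕ
  incident r x s = bit (rep Y r ∧ (C r x ∧ toS x s))

  three-per-odd-component : ∀ r → 3 * bit (rep Y r ∧ oddb (# (C r))) ≤ ∑ (λ x → ∑ (λ s → incident r x s))
  three-per-odd-component r with rep Y r in rr
  ... | false = z≤n
  ... | true with oddb (# (C r)) in o
  ... | false = z≤n
  ... | true = three-crossings r o

  one-component-per-edge : ∀ x s → ∑ (λ r → incident r x s) ≤ bit (toS x s)
  one-component-per-edge x s with toS x s in t
  ... | false = subst (_≤ 0) (sym (∑-0 (λ r → cong bit (trans (cong (rep Y r ∧_) (∧-zeroʳ (C r x))) (∧-zeroʳ (rep Y r)))))) z≤n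
  ... | true = #≤1 (λ r → rep Y r ∧ (C r x ∧ true)) at-most-one
    where
    at-most-one : ∀ i j → (rep Y i ∧ (C i x ∧ true)) ≡ true → (rep Y j ∧ (C j x ∧ true)) ≡ true → i ≡ j
    at-most-one i j ei ej = rep-unique {Y} {i} {j} {x} (proj₁ (∧-true {rep Y i} ei)) (proj₁ (∧-true {rep Y j} ej))
      (proj₁ (∧-true {C i x} (proj₂ (∧-true {rep Y i} ei)))) (proj₁ (∧-true {C j x} (proj₂ (∧-true {rep Y j} ej))))

  degree-into-S : ∀ s → ∑ (λ x → bit (toS x s)) ≡ 3 * bit (S s)
  degree-into-S s with S s
  ... | false = ∑-0 {n} {λ x → 0} (λ x → refl)
  ... | true = trans (∑-cong (λ x → cong bit (gsym G x s))) (deg s)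

  oddc≤# : oddc Y ≤ # S
  oddc≤# = *-cancelˡ-≤ 3 (begin
    3 * oddc Y ≡⟨ sym (∑-*ˡ 3 (λ r → bit (rep Y r ∧ oddb (# (C r))))) ⟩
    ∑ (λ r → 3 * bit (rep Y r ∧ oddb (# (C r)))) ≤⟨ ∑-mono three-per-odd-component ⟩
    ∑ (λ r → ∑ (λ x → ∑ (λ s → incident r x s))) ≡⟨ ∑-swap (λ r x → ∑ (λ s → incident r x s)) ⟩
    ∑ (λ x → ∑ (λ r → ∑ (λ s → incident r x s))) ≡⟨ ∑-cong (λ x → ∑-swap (λ r s → incident r x s)) ⟩
    ∑ (λ x → ∑ (λ s → ∑ (λ r → incident r x s))) ≤⟨ ∑-mono (λ x → ∑-mono (λ s → one-component-per-edge x s)) ⟩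
    ∑ (λ x → ∑ (λ s → bit (toS x s))) ≡⟨ ∑-swap (λ x s → bit (toS x s)) ⟩
    ∑ (λ s → ∑ (λ x → bit (toS x s))) ≡⟨ ∑-cong degree-into-S ⟩
    ∑ (λ s → 3 * bit (S s)) ≡⟨ ∑-*ˡ 3 (λ s → bit (S s)) ⟩
    3 * # S ∎)
    where open ≤-Reasoning

∈⇒lookup : ∀ {n} {p : Subset n} {x} → x ∈ p → lookup p x ≡ true
∈⇒lookup = []=⇒lookup

lookup⇒∈ : ∀ {n} {p : Subset n} {x} → lookup p x ≡ true → x ∈ p
lookup⇒∈ {p = p} {x} = lookup⇒[]= x p

∉⇒lookup : ∀ {n} {p : Subset n} {x} → x ∉ p → lookup p x ≡ false
∉⇒lookup {p = p} {x} x∉p with lookup p x in e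
... | false = refl
... | true = ⊥-elim (x∉p (lookup⇒∈ e))

∣p∣≡# : ∀ {n} (p : Subset n) → ∣ p ∣ ≡ # (lookup p)
∣p∣≡# [] = refl
∣p∣≡# (true ∷ p) = cong suc (∣p∣≡# p)
∣p∣≡# (false ∷ p) = ∣p∣≡# p

∣tabulate∣ : ∀ {n} (f : Fin n → Bool) → ∣ tabulate f ∣ ≡ # f
∣tabulate∣ f = trans (∣p∣≡# (tabulate f)) (#-cong (lookup∘tabulate f))

Subset-ext : ∀ {n} {p q : Subset n} → (∀ x → lookup p x ≡ lookup q x) → p ≡ q
Subset-ext {p = p} {q} e = trans (sym (tabulate∘lookup p)) (trans (tabulate-cong e) (tabulate∘lookup q))

Walk⇒W : ∀ {n} (G : Graph n) {P u v} → Walk G P u v → Walks.W G (lookup P) u v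
Walk⇒W G (here p) = Walks.here (∈⇒lookup p)
Walk⇒W G (step p a w) = Walks.step (∈⇒lookup p) a (Walk⇒W G w)

W⇒Walk : ∀ {n} (G : Graph n) {P u v} → Walks.W G (lookup P) u v → Walk G P u v
W⇒Walk G (Walks.here p) = here (lookup⇒∈ p)
W⇒Walk G (Walks.step p a w) = step (lookup⇒∈ p) a (W⇒Walk G w)

PerfectMatchingOn⇒PM : ∀ {n} (G : Graph n) (P : Subset n) → PerfectMatchingOn G P → Matchings.PM G (lookup P)
PerfectMatchingOn⇒PM G P (M , s , e , p) =
  M , s , (λ u v m → let (a , b , c) = e u v m in a , ∈⇒lookup b , ∈⇒lookup c) , (λ u x → p u (lookup⇒∈ x))

PM⇒PerfectMatchingOn : ∀ {n} (G : Graph n) (P : Subset n) → Matchings.PM G (lookup P) → PerfectMatchingOn G P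
PM⇒PerfectMatchingOn G P (M , s , e , p) =
  M , s , (λ u v m → let (a , b , c) = e u v m in a , lookup⇒∈ b , lookup⇒∈ c) , (λ u x → p u (∈⇒lookup x))

TwoConnected⇒walk-avoiding : ∀ {n} (G : Graph n) → TwoConnected G →
  ∀ s x y → ¬ x ≡ s → ¬ y ≡ s → Walks.W G (λ z → not (eqb z s)) x y
TwoConnected⇒walk-avoiding G (_ , _ , conn) s x y x≢s y≢s =
  Walks.W-mono G avoids (Walk⇒W G (conn s x y (∈minus x≢s) (∈minus y≢s)))
  where
  ∈minus : ∀ {z} → ¬ z ≡ s → z ∈ minus G s
  ∈minus z≢s = x∉p⇒x∈∁p (λ m → z≢s (x∈⁅y⁆⇒x≡y s m))
  avoids : ∀ z → lookup (minus G s) z ≡ true → not (eqb z s) ≡ true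
  avoids z e = cong not (eqb-false (λ z≡s → x∈∁p⇒x∉p (lookup⇒∈ e) (subst (_∈ ⁅ s ⁆) (sym z≡s) (x∈⁅x⁆ s))))

enumerate : ∀ {n} → (Fin n → Bool) → List (Fin n)
enumerate {zero} p = []
enumerate {suc n} p with p zero
... | true = zero ∷ map suc (enumerate (λ i → p (suc i)))
... | false = map suc (enumerate (λ i → p (suc i)))

length-enumerate : ∀ {n} (p : Fin n → Bool) → length (enumerate p) ≡ # p
length-enumerate {zero} p = refl
length-enumerate {suc n} p with p zero
... | true = cong suc (trans (length-map suc (enumerate (λ i → p (suc i)))) (length-enumerate (λ i → p (suc i))))
... | false = trans (length-map suc (enumerate (λ i → p (suc i)))) (length-enumerate (λ i → p (suc i)))

∈-enumerate⁺ : ∀ {n} (p : Fin n → Bool) i → p i ≡ true → i LM.∈ enumerate p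
∈-enumerate⁺ {suc n} p zero e with p zero
∈-enumerate⁺ {suc n} p zero e | true = here refl
∈-enumerate⁺ {suc n} p (suc i) e with p zero
... | true = there (∈-map⁺ suc (∈-enumerate⁺ (λ i → p (suc i)) i e))
... | false = ∈-map⁺ suc (∈-enumerate⁺ (λ i → p (suc i)) i e)

Unique-map-injectiveOn : ∀ {A B : Set} (f : A → B) (xs : List A) → Unique xs → (∀ {x y} → x LM.∈ xs → y LM.∈ xs → f x ≡ f y → x ≡ y) → Unique (map f xs)
Unique-map-injectiveOn f [] _ _ = []
Unique-map-injectiveOn f (x ∷ xs) (ax ∷ uxs) inj = allmap xs (λ p → p) ax ∷ Unique-map-injectiveOn f xs uxs (λ px py → inj (there px) (there py))
  where
  allmap : ∀ ys → (∀ {y} → y LM.∈ ys → y LM.∈ xs) → All (λ y → ¬ x ≡ y) ys → All (λ z → ¬ f x ≡ z) (map f ys)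
  allmap [] sub [] = []
  allmap (y ∷ ys) sub (ny ∷ a) = (λ e → ny (inj (here refl) (there (sub (here refl))) e)) ∷ allmap ys (λ p → sub (there p)) a

Unique-lookup-injective : ∀ {A : Set} (xs : List A) → Unique xs → ∀ i j → List.lookup xs i ≡ List.lookup xs j → i ≡ j
Unique-lookup-injective (x ∷ xs) u zero zero e = refl
Unique-lookup-injective (x ∷ xs) (ax ∷ u) zero (suc j) e = ⊥-elim (All.lookup ax (∈-lookup j) e)
Unique-lookup-injective (x ∷ xs) (ax ∷ u) (suc i) zero e = ⊥-elim (All.lookup ax (∈-lookup i) (sym e))
Unique-lookup-injective (x ∷ xs) (ax ∷ u) (suc i) (suc j) e = cong suc (Unique-lookup-injective xs u i j e)

∈-enumerate⁻ : ∀ {n} (p : Fin n → Bool) i → i LM.∈ enumerate p → p i ≡ true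
∈-enumerate⁻ {suc n} p i m with p zero in e
∈-enumerate⁻ {suc n} p i (here refl) | true = e
∈-enumerate⁻ {suc n} p i (there m) | true with ∈-map⁻ suc m
... | j , mj , refl = ∈-enumerate⁻ (λ i → p (suc i)) j mj
∈-enumerate⁻ {suc n} p i m | false with ∈-map⁻ suc m
... | j , mj , refl = ∈-enumerate⁻ (λ i → p (suc i)) j mj

enumerate-unique : ∀ {n} (p : Fin n → Bool) → Unique (enumerate p)
enumerate-unique {zero} p = []
enumerate-unique {suc n} p with p zero
... | true = nz (enumerate (λ i → p (suc i))) ∷ Unique-map-injectiveOn suc _ (enumerate-unique (λ i → p (suc i))) (λ _ _ → FinP.suc-injective)
  where
  nz : ∀ (ys : List (Fin n)) → All (λ y → ¬ zero ≡ y) (map suc ys)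
  nz [] = []
  nz (y ∷ ys) = (λ ()) ∷ nz ys
... | false = Unique-map-injectiveOn suc _ (enumerate-unique (λ i → p (suc i))) (λ _ _ → FinP.suc-injective)

module ComponentSubsets {n : ℕ} (G : Graph n) (S : Subset n) (Y : Fin n → Bool)
                        (lookup-∁S : ∀ x → lookup (∁ S) x ≡ Y x) where
  open Walks G using (W; W-mono; W-start)
  open Components G

  compSet : Fin n → Subset n
  compSet r = tabulate (K Y r)

  ∈compSet⇒K : ∀ {r x} → x ∈ compSet r → K Y r x ≡ true
  ∈compSet⇒K {r} {x} m = trans (sym (lookup∘tabulate (K Y r) x)) (∈⇒lookup m)

  K⇒∈compSet : ∀ {r x} → K Y r x ≡ true → x ∈ compSet r
  K⇒∈compSet {r} {x} k = lookup⇒∈ (trans (lookup∘tabulate (K Y r) x) k)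

  ∈∁S⇒Y : ∀ {x} → x ∈ ∁ S → Y x ≡ true
  ∈∁S⇒Y {x} m = trans (sym (lookup-∁S x)) (∈⇒lookup m)

  Y⇒∈∁S : ∀ {x} → Y x ≡ true → x ∈ ∁ S
  Y⇒∈∁S {x} e = lookup⇒∈ (trans (lookup-∁S x) e)

  walk-stays-in : ∀ C → IsComponent G (∁ S) C → ∀ {a x} → a ∈ C → W Y a x → x ∈ C
  walk-stays-in C comp a∈C (Walks.here _) = a∈C
  walk-stays-in C comp@(_ , _ , _ , closed) a∈C (Walks.step _ a~w rest) =
    walk-stays-in C comp (closed _ _ a∈C (Y⇒∈∁S (W-start rest)) a~w) rest

  component≡compSet : ∀ C → IsComponent G (∁ S) C → ∃ λ r → rep Y r ≡ true × C ≡ compSet r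
  component≡compSet C comp@(C⊆∁S , (v , v∈C) , walks , _) with rep-exists {Y} {v} (∈∁S⇒Y (C⊆∁S v∈C))
  ... | r , rep-r , Krv = r , rep-r , Subset-ext (λ x → trans (bool-iff (to x) (from x)) (sym (lookup∘tabulate (K Y r) x)))
    where
    to : ∀ x → lookup C x ≡ true → K Y r x ≡ true
    to x e = K-trans {Y} {r} {v} {x} Krv (walk-K (W-mono (λ _ m → ∈∁S⇒Y (lookup⇒∈ m)) (Walk⇒W G (walks v x v∈C (lookup⇒∈ e)))))
    from : ∀ x → K Y r x ≡ true → lookup C x ≡ true
    from x k = ∈⇒lookup (walk-stays-in C comp v∈C (K-walk {Y} {v} {x} (K-trans {Y} {v} {r} {x} (K-sym {Y} {r} {v} Krv) k)))

  compSet-isComponent : ∀ r → rep Y r ≡ true → IsComponent G (∁ S) (compSet r)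
  compSet-isComponent r rep-r = ⊆∁S , (r , K⇒∈compSet (K-self {Y} {r} (rep-Y {Y} {r} rep-r))) , walks , closed
    where
    ⊆∁S : compSet r ⊆ ∁ S
    ⊆∁S {x} m = Y⇒∈∁S (K-Y {Y} {r} {x} (∈compSet⇒K m))
    walks : ∀ a b → a ∈ compSet r → b ∈ compSet r → Walk G (∁ S) a b
    walks a b ma mb = W⇒Walk G (W-mono (λ z → trans (lookup-∁S z))
      (K-walk {Y} {a} {b} (K-trans {Y} {a} {r} {b} (K-sym {Y} {r} {a} (∈compSet⇒K ma)) (∈compSet⇒K mb))))
    closed : ∀ a w → a ∈ compSet r → w ∈ ∁ S → adj G a w ≡ true → w ∈ compSet r
    closed a w ma mw a~w = K⇒∈compSet (K-closed {Y} {r} {a} {w} (∈compSet⇒K ma) (∈∁S⇒Y mw) a~w)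

  ∣compSet∣%2 : ∀ r → ∣ compSet r ∣ % 2 ≡ bit (oddb (# (K Y r)))
  ∣compSet∣%2 r = trans (cong (_% 2) (∣tabulate∣ (K Y r))) (%2≡bit (# (K Y r)))

  oddRep⇒odd : ∀ {r} → oddRep Y r ≡ true → IsOddComponent G (∁ S) (compSet r)
  oddRep⇒odd {r} e = compSet-isComponent r (proj₁ (∧-true {rep Y r} e)) , trans (∣compSet∣%2 r) (cong bit (proj₂ (∧-true {rep Y r} e)))

  odd⇒oddRep : ∀ C → IsOddComponent G (∁ S) C → ∃ λ r → oddRep Y r ≡ true × C ≡ compSet r
  odd⇒oddRep C (comp , odd) with component≡compSet C comp
  ... | r , rep-r , refl = r , ∧-intro rep-r (bit≡1 (trans (sym (∣compSet∣%2 r)) odd)) , refl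

  compSet-injective : ∀ {r s} → rep Y r ≡ true → rep Y s ≡ true → compSet r ≡ compSet s → r ≡ s
  compSet-injective {r} {s} rep-r rep-s e =
    rep-unique {Y} {r} {s} {s} rep-r rep-s (∈compSet⇒K (subst (s ∈_) (sym e) (K⇒∈compSet Kss))) Kss
    where
    Kss : K Y s s ≡ true
    Kss = K-self {Y} {s} (rep-Y {Y} {s} rep-s)

  oddComponents : List (Subset n)
  oddComponents = map compSet (enumerate (oddRep Y))

  numOddComponents : NumOddComponents G (∁ S) (oddc Y)
  numOddComponents = oddComponents , unique , all-odd , complete , len
    where
    rep-of : ∀ {r} → r LM.∈ enumerate (oddRep Y) → rep Y r ≡ true
    rep-of {r} m = proj₁ (∧-true {rep Y r} (∈-enumerate⁻ (oddRep Y) r m))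
    unique : Unique oddComponents
    unique = Unique-map-injectiveOn compSet _ (enumerate-unique (oddRep Y)) (λ mr ms → compSet-injective (rep-of mr) (rep-of ms))
    all-odd : All (IsOddComponent G (∁ S)) oddComponents
    all-odd = All.tabulate odd
      where
      odd : ∀ {C} → C LM.∈ oddComponents → IsOddComponent G (∁ S) C
      odd m with ∈-map⁻ compSet m
      ... | r , mr , refl = oddRep⇒odd (∈-enumerate⁻ (oddRep Y) r mr)
    complete : ∀ C → IsOddComponent G (∁ S) C → C LM.∈ oddComponents
    complete C odd with odd⇒oddRep C odd
    ... | r , e , refl = ∈-map⁺ compSet (∈-enumerate⁺ (oddRep Y) r e)
    len : length oddComponents ≡ oddc Y
    len = trans (length-map compSet (enumerate (oddRep Y))) (length-enumerate (oddRep Y))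

  numOddComponents-≤ : ∀ {k} → NumOddComponents G (∁ S) k → k ≤ oddc Y
  numOddComponents-≤ (L , unique , all-odd , _ , refl) =
    subst (_≤ oddc Y) (#-true (length L)) (#≤#-injection (λ _ → true) (oddRep Y) R has-rep (λ i r e → proj₁ (∧-true {oddRep Y r} e)) injective)
    where
    is? : ∀ i r → Dec (List.lookup L i ≡ compSet r)
    is? i r = VP.≡-dec _≟b_ (List.lookup L i) (compSet r)
    R : Fin (length L) → Fin n → Bool
    R i r = oddRep Y r ∧ ⌊ is? i r ⌋
    ⌊is?⌋⇒≡ : ∀ {i r} → ⌊ is? i r ⌋ ≡ true → List.lookup L i ≡ compSet r
    ⌊is?⌋⇒≡ {i} {r} e with is? i r
    ... | yes p = p
    ≡⇒⌊is?⌋ : ∀ {i r} → List.lookup L i ≡ compSet r → ⌊ is? i r ⌋ ≡ true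
    ≡⇒⌊is?⌋ {i} {r} e with is? i r
    ... | yes _ = refl
    ... | no ≢ = ⊥-elim (≢ e)
    R⇒≡ : ∀ {i r} → R i r ≡ true → List.lookup L i ≡ compSet r
    R⇒≡ {i} {r} e = ⌊is?⌋⇒≡ (proj₂ (∧-true {oddRep Y r} e))
    has-rep : ∀ i → true ≡ true → ∃ λ r → R i r ≡ true
    has-rep i _ = let (r , e , L[i]≡) = odd⇒oddRep (List.lookup L i) (All.lookup all-odd (∈-lookup i))
                  in r , ∧-intro {oddRep Y r} {⌊ is? i r ⌋} e (≡⇒⌊is?⌋ {i} {r} L[i]≡)
    injective : ∀ i j r → R i r ≡ true → R j r ≡ true → i ≡ j
    injective i j r ei ej = Unique-lookup-injective L unique i j (trans (R⇒≡ ei) (sym (R⇒≡ ej)))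

-- Nice vertices and barriers

module _ {n : ℕ} (G : Graph n) (cubic : Cubic G) (u : Fin n) where
  open Components G

  degree≡3 : ∀ x → # (adj G x) ≡ 3
  degree≡3 x = trans (sym (∣tabulate∣ (adj G x))) (cubic x)

  X : Fin n → Bool
  X x = not (adj G u x ∨ eqb u x)

  lookup-∁N[u] : ∀ x → lookup (∁ (N[_] G u)) x ≡ X x
  lookup-∁N[u] x = trans (lookup-map x not (N[_] G u)) (cong not (lookup∘tabulate (λ v → adj G u v ∨ ⌊ u ≟ v ⌋) x))

  nice⇒PM : Nice G u → Matchings.PM G X
  nice⇒PM nice = Matchings.PM-≐ G lookup-∁N[u] (PerfectMatchingOn⇒PM G _ nice)

  PM⇒nice : Matchings.PM G X → Nice G u
  PM⇒nice pm = PM⇒PerfectMatchingOn G _ (Matchings.PM-≐ G (λ x → sym (lookup-∁N[u] x)) pm)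

  module AroundU (Sb : Fin n → Bool) (u∉S : Sb u ≡ false) (N⊆S : ∀ v → adj G u v ≡ true → Sb v ≡ true) where
    S∩X : Fin n → Bool
    S∩X x = Sb x ∧ X x

    #S≡#S∩X+3 : # Sb ≡ # S∩X + 3
    #S≡#S∩X+3 = trans (∑-cong split) (trans (∑-+ (λ x → bit (S∩X x)) (λ x → bit (adj G u x))) (cong (# S∩X +_) (degree≡3 u)))
      where
      split : ∀ x → bit (Sb x) ≡ bit (S∩X x) + bit (adj G u x)
      split x with adj G u x in u~x | x ≟ u
      ... | true | _ rewrite N⊆S x u~x = refl
      ... | false | yes refl rewrite u∉S = refl
      ... | false | no x≢u with Sb x
      ...   | false = refl
      ...   | true rewrite eqb-false (λ u≡x → x≢u (sym u≡x)) = refl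

    oddc-∁S≡suc : oddc (λ x → not (Sb x)) ≡ suc (oddc (λ x → X x ∧ not (S∩X x)))
    oddc-∁S≡suc = trans (IsolatedVertex.oddc-remove-isolated (λ x → not (Sb x)) Y' u (cong not u∉S) (λ v u~v → cong not (N⊆S v u~v)) (λ x → refl))
                        (cong suc (oddc-cong Y'≐))
      where
      Y' : Fin n → Bool
      Y' x = not (Sb x) ∧ not (eqb x u)
      Y'≐ : ∀ x → Y' x ≡ (X x ∧ not (S∩X x))
      Y'≐ x with adj G u x in u~x | x ≟ u
      ... | true | _ rewrite N⊆S x u~x = refl
      ... | false | yes refl rewrite u∉S | eqb-refl x = refl
      ... | false | no x≢u rewrite eqb-false (λ u≡x → x≢u (sym u≡x)) with Sb x
      ...   | true = refl
      ...   | false = refl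

  barrier⇒¬nice : (Σ (Subset n) λ S → Barrier G S × IsolatedIn G u S) → ¬ Nice G u
  barrier⇒¬nice (S , barrier , u∉S , N⊆S) nice = <-irrefl refl (begin-strict
    # Sb                                  ≡⟨ sym (∣p∣≡# S) ⟩
    ∣ S ∣                                 ≤⟨ numOddComponents-≤ barrier ⟩
    oddc (λ x → not (Sb x))               ≡⟨ oddc-∁S≡suc ⟩
    suc (oddc (λ x → X x ∧ not (S∩X x)))  ≤⟨ s≤s (tutte-easy G X S∩X (nice⇒PM nice) (λ x e → proj₂ (∧-true {Sb x} e))) ⟩
    suc (# S∩X)                           <⟨ s≤s (s≤s (n≤1+n (# S∩X))) ⟩
    3 + # S∩X                             ≡⟨ trans (+-comm 3 (# S∩X)) (sym #S≡#S∩X+3) ⟩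
    # Sb                                  ∎)
    where
    Sb : Fin n → Bool
    Sb = lookup S
    open ComponentSubsets G S (λ x → not (Sb x)) (λ x → lookup-map x not S)
    open AroundU Sb (∉⇒lookup u∉S) (λ v u~v → ∈⇒lookup (N⊆S v u~v))
    open ≤-Reasoning

  ¬nice⇒barrier : TwoConnected G → ¬ Nice G u → Σ (Subset n) λ S → Barrier G S × IsolatedIn G u S
  ¬nice⇒barrier 2conn ¬nice with Tutte.tutte X G (λ pm → ¬nice (PM⇒nice pm))
  ... | T , T⊆X , violation = tabulate Sb , barrier , isolated
    where
    Sb : Fin n → Bool
    Sb x = T x ∨ adj G u x
    T-u : T u ≡ false
    T-u with T u in e
    ... | false = refl
    ... | true = ⊥-elim (true≢false (T⊆X u e) (cong not (trans (cong (adj G u u ∨_) (eqb-refl u)) (∨-zeroʳ (adj G u u)))))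
    u∉S : Sb u ≡ false
    u∉S = cong₂ _∨_ T-u (loopless G u)
    N⊆S : ∀ v → adj G u v ≡ true → Sb v ≡ true
    N⊆S v u~v = trans (cong (T v ∨_) u~v) (∨-zeroʳ (T v))
    open AroundU Sb u∉S N⊆S
    S∩X≐T : ∀ x → S∩X x ≡ T x
    S∩X≐T x with T x in e
    ... | true = T⊆X x e
    ... | false with adj G u x
    ...   | false = refl
    ...   | true = refl
    -- |S| and o(G − S) have the same parity since n is even; this closes the gap of one.
    lower : # Sb ≤ oddc (λ x → not (Sb x))
    lower = ≤-by-parity (begin
      # Sb                                  ≡⟨ trans #S≡#S∩X+3 (trans (cong (_+ 3) (#-cong S∩X≐T)) (+-comm (# T) 3)) ⟩
      suc (suc (suc (# T)))                 ≤⟨ s≤s (s≤s violation) ⟩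
      suc (suc (oddc (λ x → X x ∧ not (T x))))  ≡⟨ cong (λ m → suc (suc m)) (oddc-cong {λ x → X x ∧ not (T x)} (λ x → cong (λ t → X x ∧ not t) (sym (S∩X≐T x)))) ⟩
      suc (suc (oddc (λ x → X x ∧ not (S∩X x)))) ≡⟨ cong suc (sym oddc-∁S≡suc) ⟩
      suc (oddc (λ x → not (Sb x)))         ∎)
      (trans (sym (#-not-parity (cubic-even-order G degree≡3) Sb)) (parity (λ x → not (Sb x))))
      where open ≤-Reasoning
    upper : oddc (λ x → not (Sb x)) ≤ # Sb
    upper = CubicBound.oddc≤# G degree≡3 (TwoConnected⇒walk-avoiding G 2conn) Sb
    barrier : Barrier G (tabulate Sb)
    barrier = subst (NumOddComponents G (∁ (tabulate Sb))) (trans (≤-antisym upper lower) (sym (∣tabulate∣ Sb))) numOddComponents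
      where open ComponentSubsets G (tabulate Sb) (λ x → not (Sb x)) (λ x → trans (lookup-map x not (tabulate Sb)) (cong not (lookup∘tabulate Sb x)))
    isolated : IsolatedIn G u (tabulate Sb)
    isolated = (λ m → true≢false (trans (sym (lookup∘tabulate Sb u)) (∈⇒lookup m)) u∉S) ,
               (λ v u~v → lookup⇒∈ (trans (lookup∘tabulate Sb v) (N⊆S v u~v)))

theorem2p3 : (n : ℕ) (G : Graph n) → TwoConnected G → Cubic G → (u : Fin n) →
    (¬ Nice G u) ⇔ (Σ (Subset n) λ S → Barrier G S × IsolatedIn G u S)
theorem2p3 n G 2conn cubic u = mk⇔ (¬nice⇒barrier G cubic u 2conn) (barrier⇒¬nice G cubic u)
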